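{- Let $K\ge1$ be an integer with $K\equiv 0\pmod 4$, and let $p_1^{a_1}p_2^{a_2}\cdots p_r^{a_r}$ be the prime factorization of $K^2+4$, where $p_1^{a_1}=2^2$. If $m>1$ is an integer with $\pi_K(m)=m$, then either $m=2$ or $m=4\cdot p_2^{j_2}\cdots p_r^{j_r}$ for some integers $j_2,\dots,j_r\ge0$.
   Context: The $K$-Fibonacci sequence is $F_{K,0}=0$, $F_{K,1}=1$, $F_{K,n}=K F_{K,n-1}+F_{K,n-2}$; for an integer $m>1$, $\pi_K(m)$ is the length of its shortest period modulo $m$. -}

module Defs where

open import Data.Nat using (ℕ; zero; suc; _+_; _*_; _<_; NonZero)
open import Data.Nat.DivMod using (_%_)
open import Data.Nat.Primality using (Prime)
open import Data.Nat.Divisibility using (_∣_)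
open import Data.Product using (_×_)
open import Relation.Binary.PropositionalEquality using (_≡_; _≢_)
open import Data.Nat using (_≤_)

F : ℕ → ℕ → ℕ
F K zero = 0
F K (suc zero) = 1
F K (suc (suc n)) = K * F K (suc n) + F K n

IsPeriod : (K m P : ℕ) → .{{NonZero m}} → Set
IsPeriod K m P = (0 < P) × (∀ n → F K (n + P) % m ≡ F K n % m)

IsShortestPeriod : (K m P : ℕ) → .{{NonZero m}} → Set
IsShortestPeriod K m P = IsPeriod K m P × (∀ Q → IsPeriod K m Q → P ≤ Q)

-- every prime factor of n is one of p_2,…,p_r, i.e. an odd prime factor of K²+4
OnlyOddPrimesOf : (K n : ℕ) → Set
OnlyOddPrimesOf K n = ∀ p → Prime p → p ∣ n → (p ∣ K * K + 4) × (p ≢ 2)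

-- Write K = 2t, so that K² + 4 = 4E with E = t² + 1, and let α = t + √E ∈ ℤ[√E], a root of
-- x² = Kx + 1. Since α ^ n = (F (n + 1) − t F n) + F n √E, the period π_K(m) is the multiplicative
-- order of α modulo m. For an odd prime q, Frobenius gives α ^ q ≡ t + E ^ ((q − 1)/2) √E (mod q):
-- if q ∤ E, then E ^ ((q − 1)/2) ≡ ±1 and the order of α modulo q divides q − 1 or 2(q + 1);
-- if q ∣ E, then α ^ q ≡ t with t² ≡ −1, so the order is 4 times a divisor of q.
-- Now let the order of α modulo m be m. Exponents combine across moduli by lifting
-- (α ^ T ≡ 1 modulo a and modulo q give α ^ (Tq) ≡ 1 modulo aq), so if m = p ^ (b + 1) s with p ∤ s
-- and α ^ T ≡ 1 modulo p s for some T with p ∤ T, then m ∣ p ^ b T, which is absurd. For the largest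
-- odd prime p ∣ m with p ∤ E such a T exists, since every other prime factor of m is 2, divides E,
-- or is smaller than p. So every odd prime factor of m divides E; one such factor forces 4 ∣ m, and
-- α ^ 4 ≡ 1 (mod 8), which holds because 4 ∣ K, excludes 8 ∣ m by the same argument at p = 2.

module Submission where

open import Data.Integer.Base using (ℤ)
open import Data.Nat.Base using (ℕ)
import Data.Nat.Base as Nat

module Arithmetic where
  open import Data.Nat.Base
  open import Data.Nat.Properties
  open import Data.Nat.Divisibility
  open import Data.Nat.Primality
  open import Data.Nat.Primality.Factorisation using (factorise; PrimeFactorisation)
  open import Data.Nat.Combinatorics using (_C_; nCk≡n!/k![n-k]!; k![n∸k]!∣n!)
  open import Data.Nat.DivMod using (m/n*n≡m)
  open import Data.Nat.Induction using (<-rec)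
  open import Data.List.Base using (List; []; _∷_)
  open import Data.Nat.ListAction using (product)
  open import Data.List.Relation.Unary.All using (All; []; _∷_)
  open import Data.Product.Base using (∃₂; ∃-syntax; _×_; _,_)
  open import Data.Sum.Base using (_⊎_; inj₁; inj₂)
  open import Function.Base using (_∘_)
  open import Relation.Nullary using (yes; no; contradiction)
  open import Relation.Binary.PropositionalEquality
  open import Data.Nat.Tactic.RingSolver using (solve-∀)

  private
    variable
      p n k c s : ℕ

  prime⇒>1 : Prime p → 1 < p
  prime⇒>1 {p} pr = nonTrivial⇒n>1 p {{prime⇒nonTrivial pr}}

  prime⇒≢1 : Prime p → p ≢ 1
  prime⇒≢1 pr p≡1 = <⇒≢ (prime⇒>1 pr) (sym p≡1)

  prime∤1 : Prime p → p ∤ 1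
  prime∤1 pr = prime⇒≢1 pr ∘ ∣1⇒≡1

  prime∤! : Prime p → n < p → p ∤ n !
  prime∤! {n = zero}  pr _   = prime∤1 pr
  prime∤! {n = suc n} pr n<p p∣n! with euclidsLemma (suc n) (n !) pr p∣n!
  ... | inj₁ p∣1+n = >⇒∤ n<p p∣1+n
  ... | inj₂ p∣n!  = prime∤! pr (<-trans (n<1+n n) n<p) p∣n!

  nCk*k!*[n∸k]!≡n! : k ≤ n → (n C k) * (k ! * (n ∸ k) !) ≡ n !
  nCk*k!*[n∸k]!≡n! {k} {n} k≤n = trans (cong (_* (k ! * (n ∸ k) !)) (nCk≡n!/k![n-k]! k≤n))
                                       (m/n*n≡m {{k !* (n ∸ k) !≢0}} (k![n∸k]!∣n! k≤n))

  prime∣C : Prime p → 0 < k → k < p → p ∣ p C k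
  prime∣C {p@(suc p′)} {k} pr 0<k k<p
    with euclidsLemma (p C k) (k ! * (p ∸ k) !) pr (subst (p ∣_) (sym (nCk*k!*[n∸k]!≡n! (<⇒≤ k<p))) (m∣m*n (p′ !)))
  ... | inj₁ p∣C = p∣C
  ... | inj₂ p∣k!*[p∸k]! with euclidsLemma (k !) ((p ∸ k) !) pr p∣k!*[p∸k]!
  ...   | inj₁ p∣k!     = contradiction p∣k! (prime∤! pr k<p)
  ...   | inj₂ p∣[p∸k]! = contradiction p∣[p∸k]! (prime∤! pr (∸-monoʳ-< 0<k (<⇒≤ k<p)))

  prime∣prime⇒≡ : ∀ {q} → Prime p → Prime q → p ∣ q → p ≡ q
  prime∣prime⇒≡ pr qr p∣q with prime⇒irreducible qr p∣q
  ... | inj₁ refl = contradiction ∣-refl (prime∤1 pr)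
  ... | inj₂ p≡q  = p≡q

  prime∤* : ∀ {m} → Prime p → p ∤ m → p ∤ n → p ∤ m * n
  prime∤* {n = n} {m = m} pr p∤m p∤n p∣mn with euclidsLemma m n pr p∣mn
  ... | inj₁ p∣m = p∤m p∣m
  ... | inj₂ p∣n = p∤n p∣n

  even⊎odd : ∀ n → (∃[ h ] n ≡ 2 * h) ⊎ (∃[ h ] n ≡ suc (2 * h))
  even⊎odd zero    = inj₁ (0 , refl)
  even⊎odd (suc n) with even⊎odd n
  ... | inj₁ (h , refl) = inj₂ (h , refl)
  ... | inj₂ (h , refl) = inj₁ (suc h , cong suc (sym (+-suc h (h + 0))))

  prime≢2⇒odd : Prime p → p ≢ 2 → ∃[ h ] p ≡ suc (2 * h)
  prime≢2⇒odd {p} pr p≢2 with even⊎odd p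
  ... | inj₁ (h , p≡2h) = contradiction (sym (prime∣prime⇒≡ prime[2] pr (divides h (trans p≡2h (*-comm 2 h))))) p≢2
  ... | inj₂ p-odd      = p-odd

  prime≢2⇒∤2 : Prime p → p ≢ 2 → p ∤ 2
  prime≢2⇒∤2 pr p≢2 p∣2 = p≢2 (prime∣prime⇒≡ pr prime[2] p∣2)

  prime≢2⇒∤4 : Prime p → p ≢ 2 → p ∤ 4
  prime≢2⇒∤4 pr p≢2 = prime∤* pr (prime≢2⇒∤2 pr p≢2) (prime≢2⇒∤2 pr p≢2)

  ∤⇒nonZero : ∀ {m} → m ∤ n → NonZero n
  ∤⇒nonZero {zero} {m} m∤0 = contradiction (m ∣0) m∤0
  ∤⇒nonZero {suc n} _      = _

  prime-power-divisor : ∀ {m} → Prime p → p ∤ m → p ^ c ∣ m * n → p ^ c ∣ n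
  prime-power-divisor {c = zero} pr p∤m _ = 1∣ _
  prime-power-divisor {p} {suc c} {n} {m} pr p∤m p^c+1∣mn
    with euclidsLemma m n pr (∣-trans (m∣m*n (p ^ c)) p^c+1∣mn)
  ... | inj₁ p∣m = contradiction p∣m p∤m
  ... | inj₂ (divides n′ refl) = subst (p ^ suc c ∣_) (*-comm p n′) (*-monoʳ-∣ p p^c∣n′)
    where
    instance _ = prime⇒nonZero pr
    p^c∣n′ : p ^ c ∣ n′
    p^c∣n′ = prime-power-divisor {c = c} pr p∤m (*-cancelˡ-∣ p (subst (p * p ^ c ∣_) (rearrange m n′ p) p^c+1∣mn))
      where
      rearrange : ∀ m n p → m * (n * p) ≡ p * (m * n)
      rearrange = solve-∀

  prime-power-∣-∣⇒∣* : ∀ {m} → Prime p → p ∤ s → p ^ c ∣ m → s ∣ m → p ^ c * s ∣ m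
  prime-power-∣-∣⇒∣* {p} {s} {c} pr p∤s p^c∣m (divides m′ refl)
    with prime-power-divisor {c = c} pr p∤s (subst (p ^ c ∣_) (*-comm m′ s) p^c∣m)
  ... | divides m″ refl = divides m″ (*-assoc m″ (p ^ c) s)

  prime-power-decomposition : Prime p → ∀ n → .{{NonZero n}} → ∃₂ λ b s → n ≡ p ^ b * s × p ∤ s
  prime-power-decomposition {p} pr = <-rec _ decompose
    where
    decompose : ∀ n → (∀ {n′} → n′ < n → .{{NonZero n′}} → ∃₂ λ b s → n′ ≡ p ^ b * s × p ∤ s)
              → .{{NonZero n}} → ∃₂ λ b s → n ≡ p ^ b * s × p ∤ s
    decompose n rec with p ∣? n
    ... | no p∤n = 0 , n , sym (*-identityˡ n) , p∤n
    ... | yes (divides n′ refl) with rec (m<m*n n′ p (prime⇒>1 pr))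
      where instance _ = m*n≢0⇒m≢0 n′
    ...   | b , s , refl , p∤s = suc b , s , rearrange (p ^ b) s p , p∤s
      where
      rearrange : ∀ a s p → a * s * p ≡ p * a * s
      rearrange = solve-∀

  prime-factor-induction : (P : ℕ → Set) → P 1 → (∀ {a n} → Prime a → a * n ∣ s → P n → P (a * n))
                         → .{{NonZero s}} → P s
  prime-factor-induction {s} P P1 P-step = subst P (sym s≡∏) (go factors factorsPrime (∣-reflexive (sym s≡∏)))
    where
    open PrimeFactorisation (factorise s) renaming (isFactorisation to s≡∏)
    go : (as : List ℕ) → All Prime as → product as ∣ s → P (product as)
    go []       []          _  = P1
    go (a ∷ as) (pa ∷ pas) ∏∣s = P-step pa ∏∣s (go as pas (∣-trans (n∣m*n a) ∏∣s))

  ∃-prime-divisor : 1 < s → ∃[ q ] Prime q × q ∣ s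
  ∃-prime-divisor {s} 1<s with prime-factor-induction {s} (λ n → n ≡ 1 ⊎ ∃[ q ] Prime q × q ∣ n)
                                 (inj₁ refl) (λ {a} {n} pa _ _ → inj₂ (a , pa , m∣m*n n))
                                 {{>-nonZero (<-trans z<s 1<s)}}
  ... | inj₁ s≡1      = contradiction s≡1 (>⇒≢ 1<s)
  ... | inj₂ divisor = divisor

  divisor-downward-induction : ∀ {m} .{{_ : NonZero m}} (P : ℕ → Set)
                             → (∀ q → q ∣ m → (∀ r → r ∣ m → q < r → P r) → P q) → ∀ q → q ∣ m → P q
  divisor-downward-induction {m} P step q q∣m = go m q q∣m (m≤n+m m q)
    where
    go : ∀ j q → q ∣ m → m ≤ q + j → P q
    go zero    q q∣m m≤q+0   = step q q∣m λ r r∣m q<r →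
      contradiction (≤-trans (∣⇒≤ r∣m) (subst (m ≤_) (+-identityʳ q) m≤q+0)) (<⇒≱ q<r)
    go (suc j) q q∣m m≤q+1+j = step q q∣m λ r r∣m q<r →
      go j r r∣m (≤-trans m≤q+1+j (subst (_≤ r + j) (sym (+-suc q j)) (+-monoˡ-≤ j q<r)))

module IntegerDivisibility where
  open import Data.Nat.Base using (ℕ; NonZero; suc; _+_; _*_)
  open import Data.Nat.Divisibility using (_∣_)
  open import Data.Nat.Primality using (Prime; euclidsLemma)
  open import Data.Sum.Base using (_⊎_; inj₁; inj₂)
  open import Data.Nat.DivMod using (_%_; _/_; m≡m%n+[m/n]*n; [m+kn]%n≡m%n)
  open import Data.Integer.Base as ℤ using (+_; -[1+_])
  import Data.Integer.Properties as ℤ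
  import Data.Integer.Divisibility.Signed as ℤ
  open import Data.Integer.Tactic.RingSolver using (solve-∀)
  open import Relation.Binary.PropositionalEquality

  private
    cancel : ∀ r x y m → (r ℤ.+ x ℤ.* m) ℤ.- (r ℤ.+ y ℤ.* m) ≡ (x ℤ.- y) ℤ.* m
    cancel = solve-∀
    x≡y+[x-y] : ∀ x y → x ≡ y ℤ.+ (x ℤ.- y)
    x≡y+[x-y] = solve-∀
    y≡x-[x-y] : ∀ x y → y ≡ x ℤ.- (x ℤ.- y)
    y≡x-[x-y] = solve-∀

  +n≡+[n%m]+[n/m]*m : ∀ n m .{{_ : NonZero m}} → + n ≡ + (n % m) ℤ.+ + (n / m) ℤ.* + m
  +n≡+[n%m]+[n/m]*m n m = begin
    + n                                   ≡⟨ cong +_ (m≡m%n+[m/n]*n n m) ⟩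
    + (n % m + n / m * m)                 ≡⟨ ℤ.pos-+ (n % m) (n / m * m) ⟩
    + (n % m) ℤ.+ + (n / m * m)           ≡⟨ cong (λ z → + (n % m) ℤ.+ z) (ℤ.pos-* (n / m) m) ⟩
    + (n % m) ℤ.+ + (n / m) ℤ.* + m       ∎
    where open ≡-Reasoning

  %≡%⇒∣- : ∀ a b m .{{_ : NonZero m}} → a % m ≡ b % m → + m ℤ.∣ + a ℤ.- + b
  %≡%⇒∣- a b m a%m≡b%m = ℤ.divides (+ (a / m) ℤ.- + (b / m)) (begin
    + a ℤ.- + b
      ≡⟨ cong₂ ℤ._-_ (+n≡+[n%m]+[n/m]*m a m) (+n≡+[n%m]+[n/m]*m b m) ⟩
    (+ (a % m) ℤ.+ + (a / m) ℤ.* + m) ℤ.- (+ (b % m) ℤ.+ + (b / m) ℤ.* + m)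
      ≡⟨ cong (λ r → (+ r ℤ.+ + (a / m) ℤ.* + m) ℤ.- (+ (b % m) ℤ.+ + (b / m) ℤ.* + m)) a%m≡b%m ⟩
    (+ (b % m) ℤ.+ + (a / m) ℤ.* + m) ℤ.- (+ (b % m) ℤ.+ + (b / m) ℤ.* + m)
      ≡⟨ cancel (+ (b % m)) (+ (a / m)) (+ (b / m)) (+ m) ⟩
    (+ (a / m) ℤ.- + (b / m)) ℤ.* + m
      ∎)
    where open ≡-Reasoning

  ∣-⇒%≡% : ∀ a b m .{{_ : NonZero m}} → + m ℤ.∣ + a ℤ.- + b → a % m ≡ b % m
  ∣-⇒%≡% a b m (ℤ.divides (+ k) a-b≡km) = trans (cong (_% m) a≡b+km) ([m+kn]%n≡m%n b k m)
    where
    a≡b+km : a ≡ b + k * m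
    a≡b+km = ℤ.+-injective (begin
      + a                    ≡⟨ x≡y+[x-y] (+ a) (+ b) ⟩
      + b ℤ.+ (+ a ℤ.- + b)  ≡⟨ cong (λ z → + b ℤ.+ z) a-b≡km ⟩
      + b ℤ.+ + k ℤ.* + m    ≡⟨ cong (λ z → + b ℤ.+ z) (ℤ.pos-* k m) ⟨
      + b ℤ.+ + (k * m)      ∎)
      where open ≡-Reasoning
  ∣-⇒%≡% a b m (ℤ.divides -[1+ k ] a-b≡-km) = sym (trans (cong (_% m) b≡a+km) ([m+kn]%n≡m%n a (suc k) m))
    where
    b≡a+km : b ≡ a + suc k * m
    b≡a+km = ℤ.+-injective (begin
      + b                                    ≡⟨ y≡x-[x-y] (+ a) (+ b) ⟩
      + a ℤ.- (+ a ℤ.- + b)                  ≡⟨ cong (λ z → + a ℤ.- z) a-b≡-km ⟩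
      + a ℤ.- (-[1+ k ] ℤ.* + m)             ≡⟨ cong (λ z → + a ℤ.+ z) (ℤ.neg-distribˡ-* -[1+ k ] (+ m)) ⟩
      + a ℤ.+ + suc k ℤ.* + m                ≡⟨ cong (λ z → + a ℤ.+ z) (ℤ.pos-* (suc k) m) ⟨
      + a ℤ.+ + (suc k * m)                  ∎)
      where open ≡-Reasoning

  prime-∣-* : ∀ {p} → Prime p → ∀ a b → + p ℤ.∣ a ℤ.* b → + p ℤ.∣ a ⊎ + p ℤ.∣ b
  prime-∣-* pr a b p∣ab with euclidsLemma ℤ.∣ a ∣ ℤ.∣ b ∣ pr (subst (_ ∣_) (ℤ.abs-* a b) (ℤ.∣⇒∣ᵤ p∣ab))
  ... | inj₁ p∣a = inj₁ (ℤ.∣ᵤ⇒∣ p∣a)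
  ... | inj₂ p∣b = inj₂ (ℤ.∣ᵤ⇒∣ p∣b)

module QuadraticIntegers (E : ℤ) where
  open import Level using (0ℓ)
  open import Data.Nat.Base as ℕ using (ℕ; zero; suc; NonZero)
  import Data.Nat.Properties as ℕ
  open import Data.Nat.Divisibility using (_∣_; _∤_; divides; ∣-refl; m%n≡0⇒n∣m)
  open import Data.Nat.DivMod using (_%_; _/_; m≡m%n+[m/n]*n; m%n<n)
  open import Data.Nat.Primality using (Prime)
  open import Data.Nat.Combinatorics using (_C_; nCn≡1)
  open import Data.Integer.Base as ℤ using (+_; +0; 0ℤ; 1ℤ)
  import Data.Integer.Properties as ℤ
  import Data.Integer.Divisibility.Signed as ℤ
  open import Data.Integer.Tactic.RingSolver using () renaming (solve to ℤ-solve; solve-∀ to ℤ-solve-∀)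
  open import Data.Fin.Base using (Fin; zero; suc; inject₁; fromℕ; toℕ)
  open import Data.Fin.Properties using (toℕ-inject₁; toℕ-fromℕ; toℕ<n)
  open import Data.Product.Base using (_,_; proj₁; proj₂) renaming (_×_ to _∧_)
  open import Data.List.Base using (_∷_; [])
  open import Data.Maybe.Base using (just; nothing)
  open import Data.Empty using (⊥; ⊥-elim)
  open import Function.Base using (_∘_)
  open import Algebra.Bundles using (CommutativeRing)
  open import Relation.Binary.Bundles using (Setoid)
  open import Relation.Binary.PropositionalEquality
  import Relation.Binary.Reasoning.Setoid as ≈-Reasoning
  open import Tactic.RingSolver using (solve; solve-∀)
  open import Tactic.RingSolver.Core.AlmostCommutativeRing using (AlmostCommutativeRing; fromCommutativeRing)
  open Arithmetic using (prime-power-∣-∣⇒∣*; prime∣C)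

  -- (a , b) stands for a + b √E.
  ℤ[√E] : Set
  ℤ[√E] = ℤ ∧ ℤ

  open import Algebra.Consequences.Propositional {A = ℤ[√E]} using (comm∧idˡ⇒idʳ; comm∧distrʳ⇒distrˡ)

  infixl 6 _+_
  infixl 7 _*_
  infix  8 -_

  _+_ : ℤ[√E] → ℤ[√E] → ℤ[√E]
  (a , b) + (c , d) = a ℤ.+ c , b ℤ.+ d

  -_ : ℤ[√E] → ℤ[√E]
  - (a , b) = ℤ.- a , ℤ.- b

  _*_ : ℤ[√E] → ℤ[√E] → ℤ[√E]
  (a , b) * (c , d) = a ℤ.* c ℤ.+ b ℤ.* d ℤ.* E , a ℤ.* d ℤ.+ b ℤ.* c

  0# 1# √E : ℤ[√E]
  0# = 0ℤ , 0ℤ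
  1# = 1ℤ , 0ℤ
  √E = 0ℤ , 1ℤ

  ι : ℤ → ℤ[√E]
  ι a = a , 0ℤ

  private
    *-assoc₁ : ∀ E a b c d e f → (a ℤ.* c ℤ.+ b ℤ.* d ℤ.* E) ℤ.* e ℤ.+ (a ℤ.* d ℤ.+ b ℤ.* c) ℤ.* f ℤ.* E
                             ≡ a ℤ.* (c ℤ.* e ℤ.+ d ℤ.* f ℤ.* E) ℤ.+ b ℤ.* (c ℤ.* f ℤ.+ d ℤ.* e) ℤ.* E
    *-assoc₁ = ℤ-solve-∀
    *-assoc₂ : ∀ E a b c d e f → (a ℤ.* c ℤ.+ b ℤ.* d ℤ.* E) ℤ.* f ℤ.+ (a ℤ.* d ℤ.+ b ℤ.* c) ℤ.* e
                             ≡ a ℤ.* (c ℤ.* f ℤ.+ d ℤ.* e) ℤ.+ b ℤ.* (c ℤ.* e ℤ.+ d ℤ.* f ℤ.* E)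
    *-assoc₂ = ℤ-solve-∀
    *-distribʳ₁ : ∀ E a b c d e f → (c ℤ.+ e) ℤ.* a ℤ.+ (d ℤ.+ f) ℤ.* b ℤ.* E
                                ≡ (c ℤ.* a ℤ.+ d ℤ.* b ℤ.* E) ℤ.+ (e ℤ.* a ℤ.+ f ℤ.* b ℤ.* E)
    *-distribʳ₁ = ℤ-solve-∀
    *-distribʳ₂ : ∀ a b c d e f → (c ℤ.+ e) ℤ.* b ℤ.+ (d ℤ.+ f) ℤ.* a
                                ≡ (c ℤ.* b ℤ.+ d ℤ.* a) ℤ.+ (e ℤ.* b ℤ.+ f ℤ.* a)
    *-distribʳ₂ = ℤ-solve-∀

    *-comm′ : ∀ x y → x * y ≡ y * x
    *-comm′ (a , b) (c , d) = cong₂ _,_ (ℤ-solve (a ∷ b ∷ c ∷ d ∷ E ∷ [])) (ℤ-solve (a ∷ b ∷ c ∷ d ∷ []))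

    *-identityˡ′ : ∀ x → 1# * x ≡ x
    *-identityˡ′ (a , b) = cong₂ _,_ (ℤ-solve (a ∷ b ∷ E ∷ [])) (ℤ-solve (a ∷ b ∷ []))

    *-distribʳ′ : ∀ x y z → (y + z) * x ≡ y * x + z * x
    *-distribʳ′ (a , b) (c , d) (e , f) = cong₂ _,_ (*-distribʳ₁ E a b c d e f) (*-distribʳ₂ a b c d e f)

  commutativeRing : CommutativeRing 0ℓ 0ℓ
  commutativeRing = record
    { Carrier = ℤ[√E] ; _≈_ = _≡_ ; _+_ = _+_ ; _*_ = _*_ ; -_ = -_ ; 0# = 0# ; 1# = 1#
    ; isCommutativeRing = record
      { isRing = record
        { +-isAbelianGroup = record
          { isGroup = record
            { isMonoid = record
              { isSemigroup = record
                { isMagma = record { isEquivalence = isEquivalence ; ∙-cong = cong₂ _+_ }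
                ; assoc = λ (a , b) (c , d) (e , f) → cong₂ _,_ (ℤ.+-assoc a c e) (ℤ.+-assoc b d f) }
              ; identity = (λ (a , b) → cong₂ _,_ (ℤ.+-identityˡ a) (ℤ.+-identityˡ b))
                         , (λ (a , b) → cong₂ _,_ (ℤ.+-identityʳ a) (ℤ.+-identityʳ b)) }
            ; inverse = (λ (a , b) → cong₂ _,_ (ℤ.+-inverseˡ a) (ℤ.+-inverseˡ b))
                      , (λ (a , b) → cong₂ _,_ (ℤ.+-inverseʳ a) (ℤ.+-inverseʳ b))
            ; ⁻¹-cong = cong -_ }
          ; comm = λ (a , b) (c , d) → cong₂ _,_ (ℤ.+-comm a c) (ℤ.+-comm b d) }
        ; *-cong = cong₂ _*_
        ; *-assoc = λ (a , b) (c , d) (e , f) → cong₂ _,_ (*-assoc₁ E a b c d e f) (*-assoc₂ E a b c d e f)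
        ; *-identity = *-identityˡ′ , comm∧idˡ⇒idʳ *-comm′ *-identityˡ′
        ; distrib = comm∧distrʳ⇒distrˡ *-comm′ *-distribʳ′ , *-distribʳ′ }
      ; *-comm = *-comm′ } }

  open CommutativeRing commutativeRing
    using (+-identityˡ; +-identityʳ; +-comm; -‿inverseʳ; *-assoc; *-comm; *-identityˡ; *-identityʳ;
           distribˡ; distribʳ; zeroˡ; zeroʳ; ring; semiring; commutativeSemiring; *-commutativeSemigroup)
  open import Algebra.Properties.Ring ring using (-‿distribʳ-*)
  open import Algebra.Properties.CommutativeSemigroup *-commutativeSemigroup using (x∙yz≈y∙xz; interchange)
  open import Algebra.Properties.Semiring.Exp semiring public using (_^_)
  open import Algebra.Properties.Semiring.Exp semiring using (^-homo-*; ^-assocʳ)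
  open import Algebra.Properties.Semiring.Mult semiring using (_×_)
  open import Algebra.Properties.Semiring.Sum semiring using (sum)
  open import Algebra.Properties.CommutativeSemiring.Binomial commutativeSemiring
    using (binomial; binomialTerm) renaming (theorem to binomial-theorem)

  private
    ℤ[√E]-ring : AlmostCommutativeRing 0ℓ 0ℓ
    ℤ[√E]-ring = fromCommutativeRing commutativeRing λ where
      (+0 , +0) → just refl
      _         → nothing

  infix 4 _≡_[mod_]

  record _≡_[mod_] (x y : ℤ[√E]) (d : ℕ) : Set where
    constructor ≡-mod
    field
      quotient : ℤ[√E]
      equality : x + - y ≡ ι (+ d) * quotient

  private
    variable
      d n : ℕ
      x y z u v : ℤ[√E]

  ≡-mod-reflexive : x ≡ y → x ≡ y [mod d ]
  ≡-mod-reflexive {x} {d = d} refl = ≡-mod 0# (trans (-‿inverseʳ x) (sym (zeroʳ (ι (+ d)))))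

  ≡-mod-refl : x ≡ x [mod d ]
  ≡-mod-refl = ≡-mod-reflexive refl

  ≡-mod-sym : x ≡ y [mod d ] → y ≡ x [mod d ]
  ≡-mod-sym {x} {y} {d} (≡-mod q x-y≡dq) = ≡-mod (- q) (begin
    y + - x            ≡⟨ solve (x ∷ y ∷ []) ℤ[√E]-ring ⟩
    - (x + - y)        ≡⟨ cong -_ x-y≡dq ⟩
    - (ι (+ d) * q)    ≡⟨ -‿distribʳ-* (ι (+ d)) q ⟩
    ι (+ d) * - q      ∎)
    where open ≡-Reasoning

  ≡-mod-trans : x ≡ y [mod d ] → y ≡ z [mod d ] → x ≡ z [mod d ]
  ≡-mod-trans {x} {y} {d} {z} (≡-mod q x-y≡dq) (≡-mod r y-z≡dr) = ≡-mod (q + r) (begin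
    x + - z                      ≡⟨ solve (x ∷ y ∷ z ∷ []) ℤ[√E]-ring ⟩
    (x + - y) + (y + - z)        ≡⟨ cong₂ _+_ x-y≡dq y-z≡dr ⟩
    ι (+ d) * q + ι (+ d) * r    ≡⟨ distribˡ (ι (+ d)) q r ⟨
    ι (+ d) * (q + r)            ∎)
    where open ≡-Reasoning

  ≡-mod-setoid : ℕ → Setoid 0ℓ 0ℓ
  ≡-mod-setoid d = record
    { Carrier = ℤ[√E] ; _≈_ = _≡_[mod d ]
    ; isEquivalence = record { refl = ≡-mod-refl ; sym = ≡-mod-sym ; trans = ≡-mod-trans } }

  +-cong-mod : x ≡ y [mod d ] → u ≡ v [mod d ] → x + u ≡ y + v [mod d ]
  +-cong-mod {x} {y} {d} {u} {v} (≡-mod q x-y≡dq) (≡-mod r u-v≡dr) = ≡-mod (q + r) (begin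
    x + u + - (y + v)            ≡⟨ solve (x ∷ y ∷ u ∷ v ∷ []) ℤ[√E]-ring ⟩
    (x + - y) + (u + - v)        ≡⟨ cong₂ _+_ x-y≡dq u-v≡dr ⟩
    ι (+ d) * q + ι (+ d) * r    ≡⟨ distribˡ (ι (+ d)) q r ⟨
    ι (+ d) * (q + r)            ∎)
    where open ≡-Reasoning

  *-congˡ-mod : ∀ z → x ≡ y [mod d ] → z * x ≡ z * y [mod d ]
  *-congˡ-mod {x} {y} {d} z (≡-mod q x-y≡dq) = ≡-mod (z * q) (begin
    z * x + - (z * y)    ≡⟨ solve (x ∷ y ∷ z ∷ []) ℤ[√E]-ring ⟩
    z * (x + - y)        ≡⟨ cong (z *_) x-y≡dq ⟩
    z * (ι (+ d) * q)    ≡⟨ x∙yz≈y∙xz z (ι (+ d)) q ⟩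
    ι (+ d) * (z * q)    ∎)
    where open ≡-Reasoning

  *-cong-mod : x ≡ y [mod d ] → u ≡ v [mod d ] → x * u ≡ y * v [mod d ]
  *-cong-mod {x} {y} {d} {u} {v} x≡y u≡v = begin
    x * u    ≡⟨ *-comm x u ⟩
    u * x    ≈⟨ *-congˡ-mod u x≡y ⟩
    u * y    ≡⟨ *-comm u y ⟩
    y * u    ≈⟨ *-congˡ-mod y u≡v ⟩
    y * v    ∎
    where open ≈-Reasoning (≡-mod-setoid d)

  ι-* : ∀ a b → ι (a ℤ.* b) ≡ ι a * ι b
  ι-* a b = cong₂ _,_ (first E a b) (second a b)
    where
    first : ∀ E a b → a ℤ.* b ≡ a ℤ.* b ℤ.+ 0ℤ ℤ.* 0ℤ ℤ.* E
    first = ℤ-solve-∀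
    second : ∀ a b → 0ℤ ≡ a ℤ.* 0ℤ ℤ.+ 0ℤ ℤ.* b
    second = ℤ-solve-∀

  ι-^ : ∀ a n → ι (a ℤ.^ n) ≡ ι a ^ n
  ι-^ a zero    = refl
  ι-^ a (suc n) = trans (ι-* a (a ℤ.^ n)) (cong (ι a *_) (ι-^ a n))

  ι-*-components : ∀ a q → ι a * q ≡ (proj₁ q ℤ.* a , proj₂ q ℤ.* a)
  ι-*-components a (q₁ , q₂) = cong₂ _,_ (first E a q₁ q₂) (second a q₁ q₂)
    where
    first : ∀ E a q₁ q₂ → a ℤ.* q₁ ℤ.+ 0ℤ ℤ.* q₂ ℤ.* E ≡ q₁ ℤ.* a
    first = ℤ-solve-∀
    second : ∀ a q₁ q₂ → a ℤ.* q₂ ℤ.+ 0ℤ ℤ.* q₁ ≡ q₂ ℤ.* a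
    second = ℤ-solve-∀

  ι-ℕ-* : ∀ m n → ι (+ (m ℕ.* n)) ≡ ι (+ m) * ι (+ n)
  ι-ℕ-* m n = trans (cong ι (ℤ.pos-* m n)) (ι-* (+ m) (+ n))

  ≡-mod-1 : x ≡ y [mod 1 ]
  ≡-mod-1 {x} {y} = ≡-mod (x + - y) (sym (*-identityˡ (x + - y)))

  ≡-mod-∣ : d ∣ n → x ≡ y [mod n ] → x ≡ y [mod d ]
  ≡-mod-∣ {d} {x = x} {y} (divides k refl) (≡-mod q x-y≡nq) = ≡-mod (ι (+ k) * q) (begin
    x + - y                  ≡⟨ x-y≡nq ⟩
    ι (+ (k ℕ.* d)) * q      ≡⟨ cong (_* q) (trans (ι-ℕ-* k d) (*-comm (ι (+ k)) (ι (+ d)))) ⟩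
    ι (+ d) * ι (+ k) * q    ≡⟨ *-assoc (ι (+ d)) (ι (+ k)) q ⟩
    ι (+ d) * (ι (+ k) * q)  ∎)
    where open ≡-Reasoning

  ι-≡-0 : d ∣ n → ι (+ n) ≡ 0# [mod d ]
  ι-≡-0 {d} {n} (divides k refl) = ≡-mod (ι (+ k)) (begin
    ι (+ (k ℕ.* d)) + - 0#   ≡⟨ +-identityʳ _ ⟩
    ι (+ (k ℕ.* d))          ≡⟨ trans (ι-ℕ-* k d) (*-comm (ι (+ k)) (ι (+ d))) ⟩
    ι (+ d) * ι (+ k)        ∎)
    where open ≡-Reasoning

  *-≡-0 : ∀ {a b} → x ≡ 0# [mod a ] → y ≡ 0# [mod b ] → x * y ≡ 0# [mod a ℕ.* b ]
  *-≡-0 {x} {y} {a} {b} (≡-mod q x≡aq) (≡-mod r y≡br) = ≡-mod (q * r) (begin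
    x * y + - 0#                      ≡⟨ +-identityʳ _ ⟩
    x * y                             ≡⟨ cong₂ _*_ (trans (sym (+-identityʳ x)) x≡aq) (trans (sym (+-identityʳ y)) y≡br) ⟩
    (ι (+ a) * q) * (ι (+ b) * r)     ≡⟨ interchange (ι (+ a)) q (ι (+ b)) r ⟩
    (ι (+ a) * ι (+ b)) * (q * r)     ≡⟨ cong (_* (q * r)) (ι-ℕ-* a b) ⟨
    ι (+ (a ℕ.* b)) * (q * r)         ∎)
    where open ≡-Reasoning

  ≡-mod⇒∣ : x ≡ y [mod d ] → + d ℤ.∣ proj₁ (x + - y) ∧ + d ℤ.∣ proj₂ (x + - y)
  ≡-mod⇒∣ {x} {y} {d} (≡-mod q x-y≡dq) = ℤ.divides (proj₁ q) (cong proj₁ x-y≡qd) , ℤ.divides (proj₂ q) (cong proj₂ x-y≡qd)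
    where
    x-y≡qd : x + - y ≡ (proj₁ q ℤ.* + d , proj₂ q ℤ.* + d)
    x-y≡qd = trans x-y≡dq (ι-*-components (+ d) q)

  ∣⇒≡-mod : + d ℤ.∣ proj₁ (x + - y) → + d ℤ.∣ proj₂ (x + - y) → x ≡ y [mod d ]
  ∣⇒≡-mod {d} (ℤ.divides q₁ eq₁) (ℤ.divides q₂ eq₂) =
    ≡-mod (q₁ , q₂) (trans (cong₂ _,_ eq₁ eq₂) (sym (ι-*-components (+ d) (q₁ , q₂))))

  ≡-mod-crt : ∀ {p c s} → Prime p → p ∤ s → x ≡ y [mod p ℕ.^ c ] → x ≡ y [mod s ] → x ≡ y [mod p ℕ.^ c ℕ.* s ]
  ≡-mod-crt {p = p} {c} {s} pr p∤s x≡y[p^c] x≡y[s] with ≡-mod⇒∣ x≡y[p^c] | ≡-mod⇒∣ x≡y[s]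
  ... | p^c∣₁ , p^c∣₂ | s∣₁ , s∣₂ = ∣⇒≡-mod (combine p^c∣₁ s∣₁) (combine p^c∣₂ s∣₂)
    where
    combine : ∀ {z} → + (p ℕ.^ c) ℤ.∣ z → + s ℤ.∣ z → + (p ℕ.^ c ℕ.* s) ℤ.∣ z
    combine p^c∣z s∣z = ℤ.∣ᵤ⇒∣ (prime-power-∣-∣⇒∣* {c = c} pr p∤s (ℤ.∣⇒∣ᵤ p^c∣z) (ℤ.∣⇒∣ᵤ s∣z))

  1#^n≡1# : ∀ n → 1# ^ n ≡ 1#
  1#^n≡1# zero    = refl
  1#^n≡1# (suc n) = trans (*-identityˡ (1# ^ n)) (1#^n≡1# n)

  ^-cong-mod : ∀ n → x ≡ y [mod d ] → x ^ n ≡ y ^ n [mod d ]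
  ^-cong-mod zero    _   = ≡-mod-refl
  ^-cong-mod (suc n) x≡y = *-cong-mod x≡y (^-cong-mod n x≡y)

  ^-≡-1 : ∀ n → x ≡ 1# [mod d ] → x ^ n ≡ 1# [mod d ]
  ^-≡-1 n x≡1 = ≡-mod-trans (^-cong-mod n x≡1) (≡-mod-reflexive (1#^n≡1# n))

  ^-+-≡ : ∀ m n → x ^ n ≡ 1# [mod d ] → x ^ (m ℕ.+ n) ≡ x ^ m [mod d ]
  ^-+-≡ {x} {d} m n xⁿ≡1 = begin
    x ^ (m ℕ.+ n)     ≡⟨ ^-homo-* x m n ⟩
    x ^ m * x ^ n     ≈⟨ *-congˡ-mod (x ^ m) xⁿ≡1 ⟩
    x ^ m * 1#        ≡⟨ *-identityʳ (x ^ m) ⟩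
    x ^ m             ∎
    where open ≈-Reasoning (≡-mod-setoid d)

  ^-%-≡ : ∀ n T .{{_ : NonZero n}} → x ^ n ≡ 1# [mod d ] → x ^ T ≡ x ^ (T % n) [mod d ]
  ^-%-≡ {x} {d} n T xⁿ≡1 = begin
    x ^ T                               ≡⟨ cong (x ^_) (m≡m%n+[m/n]*n T n) ⟩
    x ^ (T % n ℕ.+ T / n ℕ.* n)         ≡⟨ ^-homo-* x (T % n) (T / n ℕ.* n) ⟩
    x ^ (T % n) * x ^ (T / n ℕ.* n)     ≡⟨ cong (λ k → x ^ (T % n) * x ^ k) (ℕ.*-comm (T / n) n) ⟩
    x ^ (T % n) * x ^ (n ℕ.* (T / n))   ≡⟨ cong (x ^ (T % n) *_) (^-assocʳ x n (T / n)) ⟨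
    x ^ (T % n) * (x ^ n) ^ (T / n)     ≈⟨ *-congˡ-mod (x ^ (T % n)) (^-≡-1 (T / n) xⁿ≡1) ⟩
    x ^ (T % n) * 1#                    ≡⟨ *-identityʳ (x ^ (T % n)) ⟩
    x ^ (T % n)                         ∎
    where open ≈-Reasoning (≡-mod-setoid d)

  x≡y⇒x-y≡0 : x ≡ y [mod d ] → x + - y ≡ 0# [mod d ]
  x≡y⇒x-y≡0 (≡-mod q x-y≡dq) = ≡-mod q (trans (+-identityʳ _) x-y≡dq)

  x-y≡0⇒x≡y : x + - y ≡ z → z ≡ 0# [mod d ] → x ≡ y [mod d ]
  x-y≡0⇒x≡y refl (≡-mod q z≡dq) = ≡-mod q (trans (sym (+-identityʳ _)) z≡dq)

  geometric : ℤ[√E] → ℕ → ℤ[√E]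
  geometric x zero    = 0#
  geometric x (suc n) = 1# + x * geometric x n

  ^≡1+[x-1]*geometric : ∀ x n → x ^ n ≡ 1# + (x + - 1#) * geometric x n
  ^≡1+[x-1]*geometric x zero    = base x
    where
    base : ∀ x → 1# ≡ 1# + (x + - 1#) * 0#
    base = solve-∀ ℤ[√E]-ring
  ^≡1+[x-1]*geometric x (suc n) = trans (cong (x *_) (^≡1+[x-1]*geometric x n)) (step x (geometric x n))
    where
    step : ∀ x g → x * (1# + (x + - 1#) * g) ≡ 1# + (x + - 1#) * (1# + x * g)
    step = solve-∀ ℤ[√E]-ring

  geometric-≡ : ∀ n → x ≡ 1# [mod d ] → geometric x n ≡ ι (+ n) [mod d ]
  geometric-≡ zero    _   = ≡-mod-refl
  geometric-≡ {x} {d} (suc n) x≡1 = begin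
    1# + x * geometric x n   ≈⟨ +-cong-mod (≡-mod-refl {x = 1#}) (*-cong-mod x≡1 (geometric-≡ n x≡1)) ⟩
    1# + 1# * ι (+ n)        ≡⟨ cong (λ y → 1# + y) (*-identityˡ (ι (+ n))) ⟩
    ι (+ suc n)              ∎
    where open ≈-Reasoning (≡-mod-setoid d)

  -- x ^ q − 1 = (x − 1)(1 + x + ⋯ + x ^ (q − 1)), where a ∣ x − 1 and the second factor is ≡ q ≡ 0 modulo q.
  ^-≡-1-lift : ∀ {a q} → x ≡ 1# [mod a ] → x ≡ 1# [mod q ] → x ^ q ≡ 1# [mod a ℕ.* q ]
  ^-≡-1-lift {x} {a} {q} x≡1[a] x≡1[q] =
    x-y≡0⇒x≡y (factorise x (geometric x q) (^≡1+[x-1]*geometric x q))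
              (*-≡-0 (x≡y⇒x-y≡0 x≡1[a]) (≡-mod-trans (geometric-≡ q x≡1[q]) (ι-≡-0 ∣-refl)))
    where
    factorise : ∀ x g {xᵠ} → xᵠ ≡ 1# + (x + - 1#) * g → xᵠ + - 1# ≡ (x + - 1#) * g
    factorise x g refl = solve (x ∷ g ∷ []) ℤ[√E]-ring

  ×≡ι* : ∀ n v → n × v ≡ ι (+ n) * v
  ×≡ι* zero    v = sym (zeroˡ v)
  ×≡ι* (suc n) v = begin
    v + n × v               ≡⟨ cong₂ _+_ (sym (*-identityˡ v)) (×≡ι* n v) ⟩
    1# * v + ι (+ n) * v    ≡⟨ distribʳ v 1# (ι (+ n)) ⟨
    ι (+ suc n) * v         ∎
    where open ≡-Reasoning

  sum-≡-last : ∀ m (f : Fin (suc m) → ℤ[√E]) → (∀ i → f (inject₁ i) ≡ 0# [mod d ]) →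
               sum f ≡ f (fromℕ m) [mod d ]
  sum-≡-last zero    f _       = ≡-mod-reflexive (+-identityʳ (f zero))
  sum-≡-last (suc m) f f≡0 = ≡-mod-trans (+-cong-mod (f≡0 zero) (sum-≡-last m (f ∘ suc) (f≡0 ∘ suc)))
                                          (≡-mod-reflexive (+-identityˡ (f (fromℕ (suc m)))))

  freshman : ∀ {q} → Prime q → ∀ x y → (x + y) ^ q ≡ x ^ q + y ^ q [mod q ]
  freshman {suc n} pr x y = begin
    (x + y) ^ suc n                                     ≡⟨ binomial-theorem (suc n) x y ⟩
    binomialTerm x y (suc n) zero + sum inner           ≈⟨ +-cong-mod (≡-mod-refl {x = binomialTerm x y (suc n) zero})
                                                             (sum-≡-last n inner inner≡0) ⟩
    binomialTerm x y (suc n) zero + inner (fromℕ n)     ≡⟨ cong₂ _+_ first-term (last-term (toℕ (fromℕ n)) (toℕ-fromℕ n)) ⟩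
    y ^ suc n + x ^ suc n                               ≡⟨ +-comm (y ^ suc n) (x ^ suc n) ⟩
    x ^ suc n + y ^ suc n                               ∎
    where
    open ≈-Reasoning (≡-mod-setoid (suc n))
    inner : Fin (suc n) → ℤ[√E]
    inner i = binomialTerm x y (suc n) (suc i)
    inner≡0 : ∀ i → inner (inject₁ i) ≡ 0# [mod suc n ]
    inner≡0 i = begin
      (suc n C k) × b       ≡⟨ ×≡ι* (suc n C k) b ⟩
      ι (+ (suc n C k)) * b ≈⟨ *-cong-mod (ι-≡-0 (prime∣C pr ℕ.z<s k<1+n)) (≡-mod-refl {x = b}) ⟩
      0# * b                ≡⟨ zeroˡ b ⟩
      0#                    ∎
      where
      k : ℕ
      k = toℕ (suc (inject₁ i))
      b : ℤ[√E]
      b = binomial x y (suc n) (suc (inject₁ i))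
      k<1+n : k ℕ.< suc n
      k<1+n = ℕ.s<s (subst (ℕ._< n) (sym (toℕ-inject₁ i)) (toℕ<n i))
    first-term : binomialTerm x y (suc n) zero ≡ y ^ suc n
    first-term = trans (+-identityʳ (1# * y ^ suc n)) (*-identityˡ (y ^ suc n))
    last-term : ∀ j → j ≡ n → (suc n C suc j) × (x ^ suc j * y ^ (n ℕ.∸ j)) ≡ x ^ suc n
    last-term j refl = trans (cong₂ (λ c k → c × (x ^ suc n * y ^ k)) (nCn≡1 (suc n)) (ℕ.n∸n≡0 n))
                             (trans (+-identityʳ _) (*-identityʳ _))

  fermat : ∀ {q} → Prime q → ∀ c → ι (+ c) ^ q ≡ ι (+ c) [mod q ]
  fermat {suc n} pr zero    = ≡-mod-reflexive (zeroˡ (0# ^ n))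
  fermat {q}     pr (suc c) = ≡-mod-trans (freshman pr 1# (ι (+ c)))
                                          (+-cong-mod (≡-mod-reflexive (1#^n≡1# q)) (fermat pr c))

  √E*√E≡ιE : √E * √E ≡ ι E
  √E*√E≡ιE = cong₂ _,_ (trans (ℤ.+-identityˡ _) (ℤ.*-identityˡ E)) refl

  √E^odd : ∀ h → √E ^ suc (2 ℕ.* h) ≡ √E * ι (E ℤ.^ h)
  √E^odd h = cong (√E *_) (begin
    √E ^ (2 ℕ.* h)   ≡⟨ ^-assocʳ √E 2 h ⟨
    (√E ^ 2) ^ h     ≡⟨ cong (λ y → y ^ h) (trans (cong (√E *_) (*-identityʳ √E)) √E*√E≡ιE) ⟩
    ι E ^ h          ≡⟨ ι-^ E h ⟨
    ι (E ℤ.^ h)      ∎)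
    where open ≡-Reasoning

  frobenius : ∀ {q h} → Prime q → q ≡ suc (2 ℕ.* h) → ∀ c →
              (ι (+ c) + √E) ^ q ≡ ι (+ c) + √E * ι (E ℤ.^ h) [mod q ]
  frobenius {q} {h} pr refl c = begin
    (ι (+ c) + √E) ^ q             ≈⟨ freshman pr (ι (+ c)) √E ⟩
    ι (+ c) ^ q + √E ^ q           ≈⟨ +-cong-mod (fermat pr c) (≡-mod-refl {x = √E ^ q}) ⟩
    ι (+ c) + √E ^ q               ≡⟨ cong (λ y → ι (+ c) + y) (√E^odd h) ⟩
    ι (+ c) + √E * ι (E ℤ.^ h)     ∎
    where open ≈-Reasoning (≡-mod-setoid q)

  1≡-1⇒∣2 : 1# ≡ - 1# [mod d ] → d ∣ 2
  1≡-1⇒∣2 1≡-1 = ℤ.∣⇒∣ᵤ (proj₁ (≡-mod⇒∣ (+-cong-mod 1≡-1 (≡-mod-refl {x = 1#}))))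

  ^-suc-cancel : ∀ n → y * x ≡ 1# → x ^ suc n ≡ x [mod d ] → x ^ n ≡ 1# [mod d ]
  ^-suc-cancel {y} {x} {d} n yx≡1 xⁿ⁺¹≡x = begin
    x ^ n              ≡⟨ *-identityˡ (x ^ n) ⟨
    1# * x ^ n         ≡⟨ cong (_* x ^ n) yx≡1 ⟨
    y * x * x ^ n      ≡⟨ *-assoc y x (x ^ n) ⟩
    y * x ^ suc n      ≈⟨ *-congˡ-mod y xⁿ⁺¹≡x ⟩
    y * x              ≡⟨ yx≡1 ⟩
    1#                 ∎
    where open ≈-Reasoning (≡-mod-setoid d)

  x²≡-1⇒x⁴≡1 : x * x ≡ - 1# [mod d ] → x ^ 4 ≡ 1# [mod d ]
  x²≡-1⇒x⁴≡1 {x} {d} x²≡-1 = begin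
    x * (x * (x * (x * 1#)))   ≡⟨ regroup x ⟩
    (x * x) * (x * x)          ≈⟨ *-cong-mod x²≡-1 x²≡-1 ⟩
    - 1# * - 1#                ≡⟨⟩
    1#                         ∎
    where
    open ≈-Reasoning (≡-mod-setoid d)
    regroup : ∀ x → x * (x * (x * (x * 1#))) ≡ (x * x) * (x * x)
    regroup = solve-∀ ℤ[√E]-ring

  order-four : ∀ T → d ∤ 2 → x * x ≡ - 1# [mod d ] → x ^ T ≡ 1# [mod d ] → 4 ∣ T
  order-four {d} {x} T d∤2 x²≡-1 xᵀ≡1 = case-remainder (T % 4) refl
    where
    open ≈-Reasoning (≡-mod-setoid d)
    x⁴≡1 : x ^ 4 ≡ 1# [mod d ]
    x⁴≡1 = x²≡-1⇒x⁴≡1 {x = x} x²≡-1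
    x²≢1 : x ^ 2 ≡ 1# [mod d ] → ⊥
    x²≢1 x²≡1 = d∤2 (1≡-1⇒∣2 (begin
      1#        ≈⟨ x²≡1 ⟨
      x ^ 2     ≡⟨ cong (x *_) (*-identityʳ x) ⟩
      x * x     ≈⟨ x²≡-1 ⟩
      - 1#      ∎))
    x^[T%4]≡1 : ∀ {r} → T % 4 ≡ r → x ^ r ≡ 1# [mod d ]
    x^[T%4]≡1 refl = ≡-mod-trans (≡-mod-sym (^-%-≡ {x = x} 4 T x⁴≡1)) xᵀ≡1
    squared : ∀ r → x ^ r ≡ 1# [mod d ] → x ^ (r ℕ.* 2) ≡ 1# [mod d ]
    squared r xʳ≡1 = ≡-mod-trans (≡-mod-reflexive (sym (^-assocʳ x r 2))) (^-≡-1 2 xʳ≡1)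
    case-remainder : ∀ r → T % 4 ≡ r → 4 ∣ T
    case-remainder 0 T%4≡0 = m%n≡0⇒n∣m T 4 T%4≡0
    case-remainder 1 T%4≡1 = ⊥-elim (x²≢1 (squared 1 (x^[T%4]≡1 T%4≡1)))
    case-remainder 2 T%4≡2 = ⊥-elim (x²≢1 (x^[T%4]≡1 T%4≡2))
    case-remainder 3 T%4≡3 = ⊥-elim (x²≢1 (≡-mod-trans (≡-mod-sym (^-+-≡ {x = x} 2 4 x⁴≡1)) (squared 3 (x^[T%4]≡1 T%4≡3))))
    case-remainder (suc (suc (suc (suc r)))) T%4≡4+r =
      ⊥-elim (ℕ.<⇒≱ (m%n<n T 4) (subst (4 ℕ.≤_) (sym T%4≡4+r) (ℕ.m≤m+n 4 r)))

  1+x≡0⇒x≡-1 : 1# + x ≡ 0# [mod d ] → x ≡ - 1# [mod d ]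
  1+x≡0⇒x≡-1 {x} 1+x≡0 = ≡-mod-trans (≡-mod-reflexive (shift x)) (+-cong-mod 1+x≡0 (≡-mod-refl {x = - 1#}))
    where
    shift : ∀ x → x ≡ (1# + x) + - 1#
    shift = solve-∀ ℤ[√E]-ring

  module _ {u v} (v*v≡1+u*u : v * v ≡ 1# + u * u) where

    conjugate-inverse : (v + - u) * (u + v) ≡ 1#
    conjugate-inverse = begin
      (v + - u) * (u + v)       ≡⟨ difference-of-squares u v ⟩
      v * v + - (u * u)         ≡⟨ cong (λ w → w + - (u * u)) v*v≡1+u*u ⟩
      1# + u * u + - (u * u)    ≡⟨ cancel u ⟩
      1#                        ∎
      where
      open ≡-Reasoning
      difference-of-squares : ∀ u v → (v + - u) * (u + v) ≡ v * v + - (u * u)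
      difference-of-squares = solve-∀ ℤ[√E]-ring
      cancel : ∀ u → 1# + u * u + - (u * u) ≡ 1#
      cancel = solve-∀ ℤ[√E]-ring

    conjugate-negated-inverse : (u + v) * (u + - v) ≡ - 1#
    conjugate-negated-inverse = begin
      (u + v) * (u + - v)       ≡⟨ difference-of-squares u v ⟩
      u * u + - (v * v)         ≡⟨ cong (λ w → u * u + - w) v*v≡1+u*u ⟩
      u * u + - (1# + u * u)    ≡⟨ cancel u ⟩
      - 1#                      ∎
      where
      open ≡-Reasoning
      difference-of-squares : ∀ u v → (u + v) * (u + - v) ≡ u * u + - (v * v)
      difference-of-squares = solve-∀ ℤ[√E]-ring
      cancel : ∀ u → u * u + - (1# + u * u) ≡ - 1#
      cancel = solve-∀ ℤ[√E]-ring

    [u+v]^2≡1[mod4] : ∀ w → u ≡ (1# + 1#) * w → (u + v) ^ 2 ≡ 1# [mod 4 ]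
    [u+v]^2≡1[mod4] w refl = ≡-mod (w * (u + v)) (begin
      (u + v) * ((u + v) * 1#) + - 1#         ≡⟨ expand w v ⟩
      (v * v + - (1# + u * u)) + r            ≡⟨ cong (λ z → z + - (1# + u * u) + r) v*v≡1+u*u ⟩
      (1# + u * u + - (1# + u * u)) + r       ≡⟨ cong (_+ r) (-‿inverseʳ (1# + u * u)) ⟩
      0# + r                                  ≡⟨ +-identityˡ r ⟩
      r                                       ∎)
      where
      open ≡-Reasoning
      r : ℤ[√E]
      r = ι (+ 4) * (w * (u + v))
      expand : ∀ w v → let u = (1# + 1#) * w in
               (u + v) * ((u + v) * 1#) + - 1# ≡ (v * v + - (1# + u * u)) + (1# + 1# + 1# + 1#) * (w * (u + v))
      expand = solve-∀ ℤ[√E]-ring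

module Fibonacci (t : ℕ) where
  open import Data.Nat.Base as ℕ using (zero; suc; NonZero)
  import Data.Nat.Properties as ℕ
  open import Data.Nat.Divisibility using (_∣_; _∤_; divides; m%n≡0⇒n∣m)
  open import Data.Nat.DivMod using (_%_; m%n<n)
  open import Data.Nat.Primality using (Prime)
  open import Data.Integer.Base as ℤ using (+_; 0ℤ; 1ℤ)
  import Data.Integer.Properties as ℤ
  import Data.Integer.Divisibility.Signed as ℤ
  open import Data.Integer.Tactic.RingSolver using () renaming (solve-∀ to ℤ-solve-∀)
  open import Data.Nat.Tactic.RingSolver using () renaming (solve-∀ to ℕ-solve-∀)
  open import Data.Product.Base using (_×_; _,_; proj₁; proj₂)
  open import Data.Sum.Base as Sum using (_⊎_; inj₁; inj₂)
  open import Algebra.Bundles using (CommutativeRing)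
  open import Relation.Nullary using (contradiction)
  open import Relation.Binary.PropositionalEquality
  import Relation.Binary.Reasoning.Setoid as ≈-Reasoning
  open import Defs using (F; IsPeriod; IsShortestPeriod)
  open Arithmetic using (prime⇒≢1; prime≢2⇒odd; prime≢2⇒∤2)
  open IntegerDivisibility using (%≡%⇒∣-; ∣-⇒%≡%; prime-∣-*)

  K E : ℕ
  K = 2 ℕ.* t
  E = 1 ℕ.+ t ℕ.* t

  open QuadraticIntegers (+ E)
  open CommutativeRing commutativeRing using (zeroˡ; zeroʳ; +-identityʳ; *-identityʳ; *-comm; semiring; ring)
  open import Algebra.Properties.Ring ring using (-1*x≈-x)
  open import Algebra.Properties.Semiring.Exp semiring using (^-assocʳ)

  -- α is a root of x² = K x + 1.
  τ α : ℤ[√E]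
  τ = ι (+ t)
  α = τ + √E

  +E≡1+t*t : + E ≡ 1ℤ ℤ.+ + t ℤ.* + t
  +E≡1+t*t = trans (ℤ.pos-+ 1 (t ℕ.* t)) (cong (λ z → 1ℤ ℤ.+ z) (ℤ.pos-* t t))

  private
    α≡ : α ≡ (+ t , 1ℤ)
    α≡ = cong₂ _,_ (ℤ.+-identityʳ (+ t)) refl

    base : ∀ T → 1ℤ ≡ 1ℤ ℤ.- T ℤ.* 0ℤ
    base = ℤ-solve-∀
    step₁ : ∀ T a b Ez → Ez ≡ 1ℤ ℤ.+ T ℤ.* T →
            T ℤ.* (a ℤ.- T ℤ.* b) ℤ.+ 1ℤ ℤ.* b ℤ.* Ez ≡ (+ 2 ℤ.* T ℤ.* a ℤ.+ b) ℤ.- T ℤ.* a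
    step₁ T a b _ refl = identity T a b
      where
      identity : ∀ T a b →
                 T ℤ.* (a ℤ.- T ℤ.* b) ℤ.+ 1ℤ ℤ.* b ℤ.* (1ℤ ℤ.+ T ℤ.* T) ≡ (+ 2 ℤ.* T ℤ.* a ℤ.+ b) ℤ.- T ℤ.* a
      identity = ℤ-solve-∀
    step₂ : ∀ T a b → T ℤ.* b ℤ.+ 1ℤ ℤ.* (a ℤ.- T ℤ.* b) ≡ a
    step₂ = ℤ-solve-∀

    α-step : ∀ a b → α * (a ℤ.- + t ℤ.* b , b) ≡ ((+ 2 ℤ.* + t ℤ.* a ℤ.+ b) ℤ.- + t ℤ.* a , a)
    α-step a b = trans (cong (_* (a ℤ.- + t ℤ.* b , b)) α≡) (cong₂ _,_ (step₁ (+ t) a b (+ E) +E≡1+t*t) (step₂ (+ t) a b))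

  +F-rec : ∀ n → + F K (suc (suc n)) ≡ + 2 ℤ.* + t ℤ.* + F K (suc n) ℤ.+ + F K n
  +F-rec n = begin
    + (K ℕ.* F K (suc n) ℕ.+ F K n)            ≡⟨ ℤ.pos-+ (K ℕ.* F K (suc n)) (F K n) ⟩
    + (K ℕ.* F K (suc n)) ℤ.+ + F K n          ≡⟨ cong (ℤ._+ + F K n) (ℤ.pos-* K (F K (suc n))) ⟩
    + K ℤ.* + F K (suc n) ℤ.+ + F K n          ≡⟨ cong (λ k → k ℤ.* + F K (suc n) ℤ.+ + F K n) (ℤ.pos-* 2 t) ⟩
    + 2 ℤ.* + t ℤ.* + F K (suc n) ℤ.+ + F K n  ∎
    where open ≡-Reasoning

  α^-Fibonacci : ∀ n → α ^ n ≡ (+ F K (suc n) ℤ.- + t ℤ.* + F K n , + F K n)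
  α^-Fibonacci zero    = cong₂ _,_ (base (+ t)) refl
  α^-Fibonacci (suc n) = begin
    α * α ^ n                                                                ≡⟨ cong (α *_) (α^-Fibonacci n) ⟩
    α * (+ F K (suc n) ℤ.- + t ℤ.* + F K n , + F K n)                        ≡⟨ α-step (+ F K (suc n)) (+ F K n) ⟩
    ((+ 2 ℤ.* + t ℤ.* + F K (suc n) ℤ.+ + F K n) ℤ.- + t ℤ.* + F K (suc n) , + F K (suc n))
      ≡⟨ cong (λ z → (z ℤ.- + t ℤ.* + F K (suc n) , + F K (suc n))) (+F-rec n) ⟨
    (+ F K (suc (suc n)) ℤ.- + t ℤ.* + F K (suc n) , + F K (suc n))          ∎
    where open ≡-Reasoning

  infix 4 α^_≡1[mod_]

  α^_≡1[mod_] : ℕ → ℕ → Set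
  α^ T ≡1[mod d ] = α ^ T ≡ 1# [mod d ]

  private
    regroup : ∀ a b t → (a ℤ.- 1ℤ) ℤ.- t ℤ.* (b ℤ.- 0ℤ) ≡ (a ℤ.- t ℤ.* b) ℤ.- 1ℤ
    regroup = ℤ-solve-∀

  period⇒α^≡1 : ∀ {m P} .{{_ : NonZero m}} → IsPeriod K m P → α^ P ≡1[mod m ]
  period⇒α^≡1 {m} {P} (_ , periodic) =
    ≡-mod-trans (≡-mod-reflexive (α^-Fibonacci P))
                (∣⇒≡-mod {x = + F K (suc P) ℤ.- + t ℤ.* + F K P , + F K P} {y = 1#} m∣first m∣F[P])
    where
    m∣F[P] : + m ℤ.∣ + F K P ℤ.- 0ℤ
    m∣F[P] = %≡%⇒∣- (F K P) 0 m (periodic 0)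
    m∣F[1+P]-1 : + m ℤ.∣ + F K (suc P) ℤ.- 1ℤ
    m∣F[1+P]-1 = %≡%⇒∣- (F K (suc P)) 1 m (periodic 1)
    m∣first : + m ℤ.∣ (+ F K (suc P) ℤ.- + t ℤ.* + F K P) ℤ.- 1ℤ
    m∣first = subst (+ m ℤ.∣_) (regroup (+ F K (suc P)) (+ F K P) (+ t))
                    (ℤ.∣m∣n⇒∣m-n m∣F[1+P]-1 (ℤ.∣n⇒∣m*n (+ t) m∣F[P]))

  α^≡1⇒period : ∀ {m P} .{{_ : NonZero m}} → 0 ℕ.< P → α^ P ≡1[mod m ] → IsPeriod K m P
  α^≡1⇒period {m} {P} 0<P α^P≡1 = 0<P , λ n → ∣-⇒%≡% (F K (n ℕ.+ P)) (F K n) m (proj₂ (≡-mod⇒∣ (shifted n)))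
    where
    shifted : ∀ n → (+ F K (suc (n ℕ.+ P)) ℤ.- + t ℤ.* + F K (n ℕ.+ P) , + F K (n ℕ.+ P))
                  ≡ (+ F K (suc n) ℤ.- + t ℤ.* + F K n , + F K n) [mod m ]
    shifted n = ≡-mod-trans (≡-mod-reflexive (sym (α^-Fibonacci (n ℕ.+ P))))
                            (≡-mod-trans (^-+-≡ n P α^P≡1) (≡-mod-reflexive (α^-Fibonacci n)))

  IsOrder : ℕ → ℕ → Set
  IsOrder d n = α^ n ≡1[mod d ] × (∀ T → α^ T ≡1[mod d ] → n ∣ T)

  α^≡1-*ʳ : ∀ {d} T n → α^ T ≡1[mod d ] → α^ T ℕ.* n ≡1[mod d ]
  α^≡1-*ʳ T n α^T≡1 = ≡-mod-trans (≡-mod-reflexive (sym (^-assocʳ α T n))) (^-≡-1 n α^T≡1)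

  α^≡1-lift : ∀ {a q} T → α^ T ≡1[mod a ] → α^ T ≡1[mod q ] → α^ T ℕ.* q ≡1[mod a ℕ.* q ]
  α^≡1-lift {q = q} T α^T≡1[a] α^T≡1[q] =
    ≡-mod-trans (≡-mod-reflexive (sym (^-assocʳ α T q))) (^-≡-1-lift α^T≡1[a] α^T≡1[q])

  shortest-period⇒order : ∀ {m P} .{{_ : NonZero m}} → IsShortestPeriod K m P → IsOrder m P
  shortest-period⇒order {m} {P} (period@(0<P , _) , minimal) = α^P≡1 , P∣exponent
    where
    instance _ = ℕ.>-nonZero 0<P
    α^P≡1 : α^ P ≡1[mod m ]
    α^P≡1 = period⇒α^≡1 period
    P∣exponent : ∀ T → α^ T ≡1[mod m ] → P ∣ T
    P∣exponent T α^T≡1 = case-remainder (T % P) refl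
      where
      case-remainder : ∀ r → T % P ≡ r → P ∣ T
      case-remainder zero    T%P≡0   = m%n≡0⇒n∣m T P T%P≡0
      case-remainder (suc r) T%P≡1+r = contradiction (minimal (suc r) (α^≡1⇒period ℕ.z<s α^[1+r]≡1))
                                                     (ℕ.<⇒≱ (subst (ℕ._< P) T%P≡1+r (m%n<n T P)))
        where
        α^[1+r]≡1 : α^ suc r ≡1[mod m ]
        α^[1+r]≡1 = subst α^_≡1[mod m ] T%P≡1+r (≡-mod-trans (≡-mod-sym (^-%-≡ P T α^P≡1)) α^T≡1)

  √E*√E≡1+τ*τ : √E * √E ≡ 1# + τ * τ
  √E*√E≡1+τ*τ = trans √E*√E≡ιE (cong (λ y → 1# + y) (ι-ℕ-* t t))

  frobenius-α : ∀ {q h} → Prime q → q ≡ suc (2 ℕ.* h) → α ^ q ≡ τ + √E * ι ((+ E) ℤ.^ h) [mod q ]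
  frobenius-α {h = h} q-prime q≡1+2h = frobenius {h = h} q-prime q≡1+2h t

  module RamifiedPrime {q} (q-prime : Prime q) (q≢2 : q ≢ 2) (q∣E : q ∣ E) where

    τ*τ≡-1 : τ * τ ≡ - 1# [mod q ]
    τ*τ≡-1 = 1+x≡0⇒x≡-1 (≡-mod-trans (≡-mod-reflexive (sym √E*√E≡1+τ*τ))
                                      (≡-mod-trans (≡-mod-reflexive √E*√E≡ιE) (ι-≡-0 q∣E)))

    ιE^[1+h]≡0 : ∀ h → ι ((+ E) ℤ.^ suc h) ≡ 0# [mod q ]
    ιE^[1+h]≡0 h = begin
      ι ((+ E) ℤ.^ suc h)              ≡⟨ ι-* (+ E) ((+ E) ℤ.^ h) ⟩
      ι (+ E) * ι ((+ E) ℤ.^ h)        ≈⟨ *-cong-mod (ι-≡-0 q∣E) (≡-mod-refl {x = ι ((+ E) ℤ.^ h)}) ⟩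
      0# * ι ((+ E) ℤ.^ h)             ≡⟨ zeroˡ (ι ((+ E) ℤ.^ h)) ⟩
      0#                               ∎
      where open ≈-Reasoning (≡-mod-setoid q)

    α^q≡τ : α ^ q ≡ τ [mod q ]
    α^q≡τ with prime≢2⇒odd q-prime q≢2
    ... | zero  , q≡1    = contradiction q≡1 (prime⇒≢1 q-prime)
    ... | suc h , q≡1+2h = begin
      α ^ q                            ≈⟨ frobenius-α {h = suc h} q-prime q≡1+2h ⟩
      τ + √E * ι ((+ E) ℤ.^ suc h)     ≈⟨ +-cong-mod (≡-mod-refl {x = τ}) (*-congˡ-mod √E (ιE^[1+h]≡0 h)) ⟩
      τ + √E * 0#                      ≡⟨ cong (λ y → τ + y) (zeroʳ √E) ⟩
      τ + 0#                           ≡⟨ +-identityʳ τ ⟩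
      τ                                ∎
      where open ≈-Reasoning (≡-mod-setoid q)

    α^4q≡1 : α^ 4 ℕ.* q ≡1[mod q ]
    α^4q≡1 = begin
      α ^ (4 ℕ.* q)     ≡⟨ cong (α ^_) (ℕ.*-comm 4 q) ⟩
      α ^ (q ℕ.* 4)     ≡⟨ ^-assocʳ α q 4 ⟨
      (α ^ q) ^ 4       ≈⟨ ^-cong-mod 4 α^q≡τ ⟩
      τ ^ 4             ≈⟨ x²≡-1⇒x⁴≡1 {x = τ} τ*τ≡-1 ⟩
      1#                ∎
      where open ≈-Reasoning (≡-mod-setoid q)

    4∣exponent : ∀ T → α^ T ≡1[mod q ] → 4 ∣ T
    4∣exponent T α^T≡1 = order-four {x = τ} T (prime≢2⇒∤2 q-prime q≢2) τ*τ≡-1 (begin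
      τ ^ T             ≈⟨ ^-cong-mod T α^q≡τ ⟨
      (α ^ q) ^ T       ≡⟨ ^-assocʳ α q T ⟩
      α ^ (q ℕ.* T)     ≡⟨ cong (α ^_) (ℕ.*-comm q T) ⟩
      α ^ (T ℕ.* q)     ≡⟨ ^-assocʳ α T q ⟨
      (α ^ T) ^ q       ≈⟨ ^-≡-1 q α^T≡1 ⟩
      1#                ∎)
      where open ≈-Reasoning (≡-mod-setoid q)

  q∣E[Eʰ-1][Eʰ+1] : ∀ {q h} → Prime q → q ≡ suc (2 ℕ.* h) →
                     + q ℤ.∣ + E ℤ.* (((+ E) ℤ.^ h ℤ.- 1ℤ) ℤ.* ((+ E) ℤ.^ h ℤ.+ 1ℤ))
  q∣E[Eʰ-1][Eʰ+1] {q} {h} q-prime refl = subst (+ q ℤ.∣_) (factor (+ E) ((+ E) ℤ.^ h)) q∣Eᵠ-E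
    where
    q∣Eᵠ-E : + q ℤ.∣ + E ℤ.* ((+ E) ℤ.^ h ℤ.* ((+ E) ℤ.^ h ℤ.* 1ℤ)) ℤ.- + E
    q∣Eᵠ-E = subst (λ n → + q ℤ.∣ + E ℤ.* n ℤ.- + E)
                   (trans (cong ((+ E) ℤ.^_) (ℕ.*-comm 2 h)) (sym (ℤ.^-*-assoc (+ E) h 2)))
                   (proj₁ (≡-mod⇒∣ (≡-mod-trans (≡-mod-reflexive (ι-^ (+ E) q)) (fermat q-prime E))))
    factor : ∀ e y → e ℤ.* (y ℤ.* (y ℤ.* 1ℤ)) ℤ.- e ≡ e ℤ.* ((y ℤ.- 1ℤ) ℤ.* (y ℤ.+ 1ℤ))
    factor = ℤ-solve-∀

  module UnramifiedPrime {q h} (q-prime : Prime q) (q≡1+2h : q ≡ suc (2 ℕ.* h)) (q∤E : q ∤ E) where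

    Eʰ : ℤ
    Eʰ = (+ E) ℤ.^ h

    euler-criterion : ι Eʰ ≡ 1# [mod q ] ⊎ ι Eʰ ≡ - 1# [mod q ]
    euler-criterion with prime-∣-* q-prime (+ E) ((Eʰ ℤ.- 1ℤ) ℤ.* (Eʰ ℤ.+ 1ℤ)) (q∣E[Eʰ-1][Eʰ+1] {h = h} q-prime q≡1+2h)
    ... | inj₁ q∣E = contradiction (ℤ.∣⇒∣ᵤ q∣E) q∤E
    ... | inj₂ q∣[Eʰ-1][Eʰ+1] with prime-∣-* q-prime (Eʰ ℤ.- 1ℤ) (Eʰ ℤ.+ 1ℤ) q∣[Eʰ-1][Eʰ+1]
    ...   | inj₁ q∣Eʰ-1 = inj₁ (∣⇒≡-mod {x = ι Eʰ} {y = 1#} q∣Eʰ-1 (ℤ.divides 0ℤ refl))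
    ...   | inj₂ q∣Eʰ+1 = inj₂ (∣⇒≡-mod {x = ι Eʰ} {y = - 1#} q∣Eʰ+1 (ℤ.divides 0ℤ refl))

    α^q≡τ+√E*Eʰ : α ^ q ≡ τ + √E * ι Eʰ [mod q ]
    α^q≡τ+√E*Eʰ = frobenius-α {h = h} q-prime q≡1+2h

    Eʰ≡1⇒α^2h≡1 : ι Eʰ ≡ 1# [mod q ] → α^ 2 ℕ.* h ≡1[mod q ]
    Eʰ≡1⇒α^2h≡1 Eʰ≡1 = ^-suc-cancel {y = √E + - τ} {x = α} (2 ℕ.* h) (conjugate-inverse {τ} {√E} √E*√E≡1+τ*τ) (begin
      α ^ suc (2 ℕ.* h)   ≡⟨ cong (α ^_) (sym q≡1+2h) ⟩
      α ^ q               ≈⟨ α^q≡τ+√E*Eʰ ⟩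
      τ + √E * ι Eʰ       ≈⟨ +-cong-mod (≡-mod-refl {x = τ}) (*-congˡ-mod √E Eʰ≡1) ⟩
      τ + √E * 1#         ≡⟨ cong (λ z → τ + z) (*-identityʳ √E) ⟩
      α                   ∎)
      where open ≈-Reasoning (≡-mod-setoid q)

    α^q≡τ-√E : ι Eʰ ≡ - 1# [mod q ] → α ^ q ≡ τ + - √E [mod q ]
    α^q≡τ-√E Eʰ≡-1 = begin
      α ^ q               ≈⟨ α^q≡τ+√E*Eʰ ⟩
      τ + √E * ι Eʰ       ≈⟨ +-cong-mod (≡-mod-refl {x = τ}) (*-congˡ-mod √E Eʰ≡-1) ⟩
      τ + √E * - 1#       ≡⟨ cong (λ z → τ + z) (trans (*-comm √E (- 1#)) (-1*x≈-x √E)) ⟩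
      τ + - √E            ∎
      where open ≈-Reasoning (≡-mod-setoid q)

    Eʰ≡-1⇒α^4[1+h]≡1 : ι Eʰ ≡ - 1# [mod q ] → α^ 4 ℕ.* suc h ≡1[mod q ]
    Eʰ≡-1⇒α^4[1+h]≡1 Eʰ≡-1 = begin
      α ^ (4 ℕ.* suc h)             ≡⟨ cong (α ^_) exponent ⟩
      α ^ (suc q ℕ.* 2)             ≡⟨ ^-assocʳ α (suc q) 2 ⟨
      (α * α ^ q) ^ 2               ≈⟨ ^-cong-mod 2 (*-congˡ-mod α (α^q≡τ-√E Eʰ≡-1)) ⟩
      (α * (τ + - √E)) ^ 2          ≡⟨ cong (_^ 2) (conjugate-negated-inverse {τ} {√E} √E*√E≡1+τ*τ) ⟩
      (- 1#) ^ 2                    ≡⟨⟩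
      1#                            ∎
      where
      open ≈-Reasoning (≡-mod-setoid q)
      exponent : 4 ℕ.* suc h ≡ suc q ℕ.* 2
      exponent = trans (arithmetic h) (cong (λ n → suc n ℕ.* 2) (sym q≡1+2h))
        where
        arithmetic : ∀ h → 4 ℕ.* suc h ≡ suc (suc (2 ℕ.* h)) ℕ.* 2
        arithmetic = ℕ-solve-∀

    unramified-prime : α^ 2 ℕ.* h ≡1[mod q ] ⊎ α^ 4 ℕ.* suc h ≡1[mod q ]
    unramified-prime = Sum.map Eʰ≡1⇒α^2h≡1 Eʰ≡-1⇒α^4[1+h]≡1 euler-criterion

  module _ {k} (t≡2k : t ≡ 2 ℕ.* k) where

    α^2≡1[mod4] : α^ 2 ≡1[mod 4 ]
    α^2≡1[mod4] = [u+v]^2≡1[mod4] {τ} {√E} √E*√E≡1+τ*τ (ι (+ k)) (trans (cong (λ n → ι (+ n)) t≡2k) (ι-ℕ-* 2 k))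

    α^4≡1[mod8] : α^ 4 ≡1[mod 8 ]
    α^4≡1[mod8] = ≡-mod-trans (≡-mod-reflexive (sym (^-assocʳ α 2 2)))
                              (^-≡-1-lift {a = 4} {q = 2} α^2≡1[mod4] (≡-mod-∣ (divides 2 refl) α^2≡1[mod4]))

module OrderValuation (t : ℕ) where
  open import Data.Nat.Base
  open import Data.Nat.Properties
  open import Data.Nat.Divisibility
  open import Data.Nat.Primality using (Prime; prime⇒nonZero; prime[2])
  open import Data.Integer.Base using (+_)
  open import Data.Product.Base using (∃-syntax; _×_; _,_)
  open import Data.Sum.Base using ([_,_]′)
  open import Data.Empty using (⊥)
  open import Function.Base using (_∘_)
  open import Relation.Nullary using (contradiction)
  open import Relation.Binary.PropositionalEquality
  open import Data.Nat.Tactic.RingSolver using (solve-∀)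
  open Arithmetic
    using (prime⇒≢1; prime∤1; prime∤*; prime∣prime⇒≡; prime≢2⇒odd; prime≢2⇒∤2; prime≢2⇒∤4; prime-factor-induction)
  open Fibonacci t using (E; α^_≡1[mod_]; IsOrder; α^≡1-*ʳ; α^≡1-lift; module RamifiedPrime; module UnramifiedPrime;
                          α^2≡1[mod4]; α^4≡1[mod8])
  open QuadraticIntegers (+ E) using (≡-mod-1; ≡-mod-∣; ≡-mod-crt)

  -- The p-adic valuation of the multiplicative order of α modulo d is at most c.
  OrderValuation≤ : ℕ → ℕ → ℕ → Set
  OrderValuation≤ p d c = ∃[ T ] p ∤ T × α^ p ^ c * T ≡1[mod d ]

  private
    variable
      p c d s : ℕ

  order-valuation-1 : Prime p → OrderValuation≤ p 1 c
  order-valuation-1 p-prime = 1 , prime∤1 p-prime , ≡-mod-1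

  order-valuation-0 : ∀ T → p ∤ T → α^ T ≡1[mod d ] → OrderValuation≤ p d 0
  order-valuation-0 {d = d} T p∤T α^T≡1 = T , p∤T , subst (α^_≡1[mod d ]) (sym (*-identityˡ T)) α^T≡1

  order-valuation-* : ∀ {a b} → Prime p → p ∤ b →
                      OrderValuation≤ p a c → OrderValuation≤ p b c → OrderValuation≤ p (a * b) c
  order-valuation-* {p} {c} {a} {b} p-prime p∤b (T₁ , p∤T₁ , α^T₁≡1) (T₂ , p∤T₂ , α^T₂≡1) =
    T₁ * T₂ * b , prime∤* p-prime (prime∤* p-prime p∤T₁ p∤T₂) p∤b ,
    subst (α^_≡1[mod a * b ]) (rearrange (p ^ c) T₁ T₂ b)
      (α^≡1-lift (p ^ c * T₁ * T₂) (α^≡1-*ʳ (p ^ c * T₁) T₂ α^T₁≡1)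
                                    (subst (α^_≡1[mod b ]) (swap (p ^ c) T₂ T₁) (α^≡1-*ʳ (p ^ c * T₂) T₁ α^T₂≡1)))
    where
    rearrange : ∀ x y z w → x * y * z * w ≡ x * (y * z * w)
    rearrange = solve-∀
    swap : ∀ x y z → x * y * z ≡ x * z * y
    swap = solve-∀

  order-valuation-crt : ∀ {e} → Prime p → p ∤ s →
                        OrderValuation≤ p (p ^ e) c → OrderValuation≤ p s c → OrderValuation≤ p (p ^ e * s) c
  order-valuation-crt {p} {s} {c} {e} p-prime p∤s (T₁ , p∤T₁ , α^T₁≡1) (T₂ , p∤T₂ , α^T₂≡1) =
    T₁ * T₂ , prime∤* p-prime p∤T₁ p∤T₂ ,
    ≡-mod-crt {c = e} p-prime p∤s (subst (α^_≡1[mod p ^ e ]) (*-assoc (p ^ c) T₁ T₂) (α^≡1-*ʳ (p ^ c * T₁) T₂ α^T₁≡1))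
                          (subst (α^_≡1[mod s ]) (swap (p ^ c) T₂ T₁) (α^≡1-*ʳ (p ^ c * T₂) T₁ α^T₂≡1))
    where
    swap : ∀ x y z → x * y * z ≡ x * (z * y)
    swap = solve-∀

  order-valuation-from-prime-divisors : Prime p → p ∤ s → .{{NonZero s}} →
    (∀ a → Prime a → a ∣ s → OrderValuation≤ p a c) → OrderValuation≤ p s c
  order-valuation-from-prime-divisors {p} {s} {c} p-prime p∤s prime-case =
    prime-factor-induction (λ n → OrderValuation≤ p n c) (order-valuation-1 {c = c} p-prime) step
    where
    step : ∀ {a n} → Prime a → a * n ∣ s → OrderValuation≤ p n c → OrderValuation≤ p (a * n) c
    step {a} {n} a-prime a*n∣s ov-n = subst (λ d → OrderValuation≤ p d c) (*-comm n a)
      (order-valuation-* {c = c} {a = n} {b = a} p-prime (λ p∣a → p∤s (∣-trans p∣a a∣s)) ov-n (prime-case a a-prime a∣s))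
      where
      a∣s : a ∣ s
      a∣s = ∣-trans (m∣m*n n) a*n∣s

  α^≡1-lift-power : ∀ {p N} j X → p ∣ N → α^ X ≡1[mod N ] → α^ p ^ j * X ≡1[mod p ^ j * N ]
  α^≡1-lift-power {p} {N} zero    X _   α^X≡1 = subst₂ α^_≡1[mod_] (sym (*-identityˡ X)) (sym (*-identityˡ N)) α^X≡1
  α^≡1-lift-power {p} {N} (suc j) X p∣N α^X≡1 = subst₂ α^_≡1[mod_] (rearrange (p ^ j) X p) (rearrange (p ^ j) N p)
    (α^≡1-lift {a = p ^ j * N} {q = p} (p ^ j * X) α^[p^j*X]≡1 (≡-mod-∣ (∣n⇒∣m*n (p ^ j) p∣N) α^[p^j*X]≡1))
    where
    α^[p^j*X]≡1 : α^ p ^ j * X ≡1[mod p ^ j * N ]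
    α^[p^j*X]≡1 = α^≡1-lift-power j X p∣N α^X≡1
    rearrange : ∀ a b p → a * b * p ≡ p * a * b
    rearrange = solve-∀

  order-valuation-contradiction : ∀ {m j} → IsOrder m m → Prime p → m ≡ p ^ j * (p ^ suc c * s) →
                                  OrderValuation≤ p (p ^ suc c * s) c → ⊥
  order-valuation-contradiction {p} {c} {s} {m} {j} (_ , m∣exponent) p-prime m≡p^j*p^[1+c]*s (T , p∤T , α^p^c*T≡1) =
    p∤T (∣-trans (m∣m*n s) p*s∣T)
    where
    instance _ = prime⇒nonZero p-prime
    m∣p^j*p^c*T : m ∣ p ^ j * (p ^ c * T)
    m∣p^j*p^c*T = m∣exponent _ (subst (α^ p ^ j * (p ^ c * T) ≡1[mod_]) (sym m≡p^j*p^[1+c]*s)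
                                  (α^≡1-lift-power j (p ^ c * T) (∣m⇒∣m*n s (m∣m*n (p ^ c))) α^p^c*T≡1))
    p*s∣T : p * s ∣ T
    p*s∣T = *-cancelˡ-∣ (p ^ c) {{m^n≢0 p c}} (subst (_∣ p ^ c * T) (rearrange (p ^ c) p s)
              (*-cancelˡ-∣ (p ^ j) {{m^n≢0 p j}} (subst (_∣ p ^ j * (p ^ c * T)) m≡p^j*p^[1+c]*s m∣p^j*p^c*T)))
      where
      rearrange : ∀ x p s → p * x * s ≡ x * (p * s)
      rearrange = solve-∀

  ramified-valuation : Prime p → p ≢ 2 → ∀ {a} → Prime a → a ≢ 2 → a ∣ E → a ≢ p → OrderValuation≤ p a 0
  ramified-valuation {p} p-prime p≢2 {a} a-prime a≢2 a∣E a≢p =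
    order-valuation-0 (4 * a) (prime∤* p-prime (prime≢2⇒∤4 p-prime p≢2) (a≢p ∘ sym ∘ prime∣prime⇒≡ p-prime a-prime))
                      (RamifiedPrime.α^4q≡1 a-prime a≢2 a∣E)

  ramified-valuation-at-2 : ∀ {a} → Prime a → a ≢ 2 → a ∣ E → OrderValuation≤ 2 a 2
  ramified-valuation-at-2 {a} a-prime a≢2 a∣E =
    a , (λ 2∣a → a≢2 (sym (prime∣prime⇒≡ prime[2] a-prime 2∣a))) , RamifiedPrime.α^4q≡1 a-prime a≢2 a∣E

  unramified-valuation : Prime p → p ≢ 2 → ∀ {a} → Prime a → a ≢ 2 → a ∤ E → a ≤ p → OrderValuation≤ p a 0
  unramified-valuation {p} p-prime p≢2 {a} a-prime a≢2 a∤E a≤p with prime≢2⇒odd a-prime a≢2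
  ... | zero  , a≡1    = contradiction a≡1 (prime⇒≢1 a-prime)
  ... | suc h , a≡1+2h = [ from-split-prime , from-inert-prime ]′
                           (UnramifiedPrime.unramified-prime {h = suc h} a-prime a≡1+2h a∤E)
    where
    2[1+h]<p : 2 * suc h < p
    2[1+h]<p = subst (_≤ p) a≡1+2h a≤p
    2+h<p : suc (suc h) < p
    2+h<p = ≤-trans (≤-trans (m≤m+n (suc (suc (suc h))) h) (≤-reflexive (arithmetic h))) 2[1+h]<p
      where
      arithmetic : ∀ h → suc (suc (suc h)) + h ≡ suc (2 * suc h)
      arithmetic = solve-∀
    from-split-prime : α^ 2 * suc h ≡1[mod a ] → OrderValuation≤ p a 0
    from-split-prime = order-valuation-0 (2 * suc h) (>⇒∤ 2[1+h]<p)
    from-inert-prime : α^ 4 * suc (suc h) ≡1[mod a ] → OrderValuation≤ p a 0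
    from-inert-prime = order-valuation-0 (4 * suc (suc h)) (prime∤* p-prime (prime≢2⇒∤4 p-prime p≢2) (>⇒∤ 2+h<p))

  two-valuation : ∀ {k} → t ≡ 2 * k → Prime p → p ≢ 2 → OrderValuation≤ p 2 0
  two-valuation {k = k} t≡2k p-prime p≢2 =
    order-valuation-0 2 (prime≢2⇒∤2 p-prime p≢2) (≡-mod-∣ (divides 2 refl) (α^2≡1[mod4] {k} t≡2k))

  eight-valuation : ∀ {k} → t ≡ 2 * k → OrderValuation≤ 2 8 2
  eight-valuation {k = k} t≡2k = 1 , prime∤1 prime[2] , α^4≡1[mod8] {k} t≡2k

module OrderEqualsModulus (k : ℕ) {m : ℕ} .{{_ : Nat.NonZero m}}
                          (order : Fibonacci.IsOrder (2 Nat.* k) m m) where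
  open import Data.Nat.Base
  open import Data.Nat.Properties
  open import Data.Nat.Divisibility
  open import Data.Nat.Primality using (Prime; prime[2])
  open import Data.Integer.Base using (+_)
  open import Data.Product.Base using (∃-syntax; _×_; _,_; proj₁)
  open import Data.Sum.Base using (_⊎_; inj₁; inj₂; [_,_]′)
  open import Data.Empty using (⊥; ⊥-elim)
  open import Relation.Nullary using (yes; no; contradiction)
  open import Relation.Binary.PropositionalEquality
  open import Data.Nat.Tactic.RingSolver using (solve-∀)
  open import Function.Base using (_∘_)
  open Arithmetic using (∤⇒nonZero; prime-power-decomposition; divisor-downward-induction; ∃-prime-divisor)
  open Fibonacci (2 * k) using (E; module RamifiedPrime)
  open OrderValuation (2 * k)
  open QuadraticIntegers (+ E) using (≡-mod-∣)

  OnlyRamifiedAbove : ℕ → Set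
  OnlyRamifiedAbove p = ∀ r → r ∣ m → p < r → Prime r → r ≡ 2 ⊎ r ∣ E

  no-largest-unramified-prime : ∀ {p} → Prime p → p ≢ 2 → p ∤ E → p ∣ m → OnlyRamifiedAbove p → ⊥
  no-largest-unramified-prime {p} p-prime p≢2 p∤E p∣m larger with prime-power-decomposition p-prime m
  ... | zero  , s , m≡s , p∤s = p∤s (subst (p ∣_) (trans m≡s (*-identityˡ s)) p∣m)
  ... | suc j , s , m≡p^[1+j]*s , p∤s =
    order-valuation-contradiction {c = 0} {j = j} order p-prime m≡p^j*[p^1*s]
      (order-valuation-crt {c = 0} {e = 1} p-prime p∤s
        (subst (λ d → OrderValuation≤ p d 0) (sym (*-identityʳ p)) (unramified-valuation p-prime p≢2 p-prime p≢2 p∤E ≤-refl))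
        (order-valuation-from-prime-divisors {c = 0} p-prime p∤s {{∤⇒nonZero p∤s}} λ a a-prime a∣s →
          divisor-valuation a-prime (∣-trans a∣s s∣m) (λ a≡p → p∤s (subst (_∣ s) a≡p a∣s))))
    where
    m≡p^j*[p^1*s] : m ≡ p ^ j * (p ^ 1 * s)
    m≡p^j*[p^1*s] = trans m≡p^[1+j]*s (rearrange p (p ^ j) s)
      where
      rearrange : ∀ p x s → p * x * s ≡ x * (p * 1 * s)
      rearrange = solve-∀
    s∣m : s ∣ m
    s∣m = divides (p ^ suc j) m≡p^[1+j]*s
    divisor-valuation : ∀ {a} → Prime a → a ∣ m → a ≢ p → OrderValuation≤ p a 0
    divisor-valuation {a} a-prime a∣m a≢p with a ≟ 2 | a ∣? E
    ... | yes refl | _       = two-valuation {k = k} refl p-prime p≢2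
    ... | no a≢2   | yes a∣E = ramified-valuation p-prime p≢2 a-prime a≢2 a∣E a≢p
    ... | no a≢2   | no a∤E  = unramified-valuation p-prime p≢2 a-prime a≢2 a∤E a≤p
      where
      a≤p : a ≤ p
      a≤p = ≮⇒≥ λ p<a → [ a≢2 , a∤E ]′ (larger a a∣m p<a a-prime)

  prime-divisor-ramified : ∀ p → Prime p → p ∣ m → p ≡ 2 ⊎ p ∣ E
  prime-divisor-ramified p p-prime p∣m = divisor-downward-induction (λ p → Prime p → p ≡ 2 ⊎ p ∣ E) step p p∣m p-prime
    where
    step : ∀ p → p ∣ m → OnlyRamifiedAbove p → Prime p → p ≡ 2 ⊎ p ∣ E
    step p p∣m larger p-prime with p ≟ 2 | p ∣? E
    ... | yes p≡2 | _       = inj₁ p≡2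
    ... | no _    | yes p∣E = inj₂ p∣E
    ... | no p≢2  | no p∤E  = ⊥-elim (no-largest-unramified-prime p-prime p≢2 p∤E p∣m larger)

  odd-prime-divisor⇒4∣m : ∀ {q} → Prime q → q ≢ 2 → q ∣ m → 4 ∣ m
  odd-prime-divisor⇒4∣m {q} q-prime q≢2 q∣m with prime-divisor-ramified q q-prime q∣m
  ... | inj₁ q≡2 = contradiction q≡2 q≢2
  ... | inj₂ q∣E = RamifiedPrime.4∣exponent q-prime q≢2 q∣E m (≡-mod-∣ q∣m (proj₁ order))

  odd-part-trivial-or-4∣m : ∀ {s} → s ∣ m → 2 ∤ s → s ≡ 1 ⊎ 4 ∣ m
  odd-part-trivial-or-4∣m {s} s∣m 2∤s with s ≟ 1
  ... | yes s≡1 = inj₁ s≡1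
  ... | no s≢1 with ∃-prime-divisor (≤∧≢⇒< (>-nonZero⁻¹ s {{∤⇒nonZero 2∤s}}) (s≢1 ∘ sym))
  ...   | q , q-prime , q∣s = inj₂ (odd-prime-divisor⇒4∣m q-prime (λ { refl → 2∤s q∣s }) (∣-trans q∣s s∣m))

  2-adic-valuation≤2 : ∀ j {s} → 2 ∤ s → m ≢ 2 ^ (3 + j) * s
  2-adic-valuation≤2 j {s} 2∤s m≡2^[3+j]*s =
    order-valuation-contradiction {c = 2} {s = s} {j = j} order prime[2] m≡2^j*[2^3*s]
      (order-valuation-crt {c = 2} {e = 3} prime[2] 2∤s (eight-valuation {k = k} refl)
        (order-valuation-from-prime-divisors {c = 2} prime[2] 2∤s {{∤⇒nonZero 2∤s}} λ a a-prime a∣s →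
          ramified-valuation-at-2 a-prime (a≢2 a∣s) (ramified a a-prime a∣s)))
    where
    a≢2 : ∀ {a} → a ∣ s → a ≢ 2
    a≢2 a∣s refl = 2∤s a∣s
    ramified : ∀ a → Prime a → a ∣ s → a ∣ E
    ramified a a-prime a∣s with prime-divisor-ramified a a-prime (∣-trans a∣s (divides (2 ^ (3 + j)) m≡2^[3+j]*s))
    ... | inj₁ a≡2 = contradiction a≡2 (a≢2 a∣s)
    ... | inj₂ a∣E = a∣E
    m≡2^j*[2^3*s] : m ≡ 2 ^ j * (2 ^ 3 * s)
    m≡2^j*[2^3*s] = trans m≡2^[3+j]*s (rearrange (2 ^ j) s)
      where
      rearrange : ∀ x s → 2 * (2 * (2 * x)) * s ≡ x * (8 * s)
      rearrange = solve-∀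

  two-or-four-times-odd : 1 < m → m ≡ 2 ⊎ ∃[ s ] m ≡ 4 * s × 2 ∤ s
  two-or-four-times-odd 1<m with prime-power-decomposition prime[2] m
  ... | b , s , m≡2^b*s , 2∤s = by-exponent b m≡2^b*s (odd-part-trivial-or-4∣m (divides (2 ^ b) m≡2^b*s) 2∤s)
    where
    by-exponent : ∀ b → m ≡ 2 ^ b * s → s ≡ 1 ⊎ 4 ∣ m → m ≡ 2 ⊎ ∃[ s ] m ≡ 4 * s × 2 ∤ s
    by-exponent 0             m≡s  (inj₁ refl) = contradiction m≡s (>⇒≢ 1<m)
    by-exponent 0             m≡s  (inj₂ 4∣m)  = contradiction 2∣s 2∤s
      where
      2∣s : 2 ∣ s
      2∣s = ∣-trans (divides 2 refl) (subst (4 ∣_) (trans m≡s (*-identityˡ s)) 4∣m)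
    by-exponent 1             m≡2s (inj₁ refl) = inj₁ m≡2s
    by-exponent 1             m≡2s (inj₂ 4∣m)  = contradiction 2∣s 2∤s
      where
      2∣s : 2 ∣ s
      2∣s = *-cancelˡ-∣ 2 (subst (4 ∣_) m≡2s 4∣m)
    by-exponent 2             m≡4s _           = inj₂ (s , m≡4s , 2∤s)
    by-exponent (suc (suc (suc j))) m≡2^[3+j]*s _ = ⊥-elim (2-adic-valuation≤2 j 2∤s m≡2^[3+j]*s)

  classification : 1 < m → m ≡ 2 ⊎ ∃[ n ] m ≡ 4 * n × (∀ p → Prime p → p ∣ n → p ∣ E × p ≢ 2)
  classification 1<m with two-or-four-times-odd 1<m
  ... | inj₁ m≡2              = inj₁ m≡2
  ... | inj₂ (n , m≡4n , 2∤n) = inj₂ (n , m≡4n , odd-ramified)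
    where
    odd-ramified : ∀ p → Prime p → p ∣ n → p ∣ E × p ≢ 2
    odd-ramified p p-prime p∣n with prime-divisor-ramified p p-prime (subst (p ∣_) (sym m≡4n) (∣n⇒∣m*n 4 p∣n))
    ... | inj₁ refl = contradiction p∣n 2∤n
    ... | inj₂ p∣E  = p∣E , λ { refl → 2∤n p∣n }

open import Defs
open import Data.Nat using (ℕ; _*_; _<_; _≤_; NonZero)
open import Data.Nat.Divisibility using (_∣_)
open import Data.Product using (Σ; _×_)
open import Data.Sum using (_⊎_)
open import Relation.Binary.PropositionalEquality using (_≡_)
open import Data.Nat using (_+_)
open import Data.Nat.Divisibility using (divides; ∣-trans)
open import Data.Nat.Primality using (Prime)
open import Data.Product using (_,_; map₁)
import Data.Sum as Sum
open import Relation.Binary.PropositionalEquality using (_≢_; refl; subst)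
open import Data.Nat.Tactic.RingSolver using (solve-∀)

E∣K*K+4 : ∀ k → Fibonacci.E (2 * k) ∣ k * 4 * (k * 4) + 4
E∣K*K+4 k = divides 4 (K*K+4≡4*E k)
  where
  K*K+4≡4*E : ∀ k → k * 4 * (k * 4) + 4 ≡ 4 * (1 + 2 * k * (2 * k))
  K*K+4≡4*E = solve-∀

ramified⇒only-odd-primes : ∀ k {n} → (∀ p → Prime p → p ∣ n → p ∣ Fibonacci.E (2 * k) × p ≢ 2) →
                           OnlyOddPrimesOf (k * 4) n
ramified⇒only-odd-primes k ramified p p-prime p∣n = map₁ (λ p∣E → ∣-trans p∣E (E∣K*K+4 k)) (ramified p p-prime p∣n)

theorem3p8 : (K m : ℕ) → 1 ≤ K → 4 ∣ K → 1 < m → .{{_ : NonZero m}}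
           → IsShortestPeriod K m m
           → (m ≡ 2) ⊎ Σ ℕ (λ n → (m ≡ 4 * n) × OnlyOddPrimesOf K n)
theorem3p8 .(k * 4) m _ (divides k refl) 1<m shortest =
  Sum.map₂ (λ (n , m≡4n , ramified) → n , m≡4n , ramified⇒only-odd-primes k ramified)
           (OrderEqualsModulus.classification k order 1<m)
  where
  order : Fibonacci.IsOrder (2 * k) m m
  order = Fibonacci.shortest-period⇒order (2 * k) (subst (λ K → IsShortestPeriod K m m) (k*4≡2*[2*k] k) shortest)
    where
    k*4≡2*[2*k] : ∀ k → k * 4 ≡ 2 * (2 * k)
    k*4≡2*[2*k] = solve-∀
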